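{- Let $D=(E,\mathcal{F})$ be a binary $\Delta$-matroid. Then there is a finite sequence of handle slides that sends $D$ to a $\Delta$-matroid whose collection of feasible sets contains exactly one feasible set of minimum size and exactly one feasible set of maximum size.
   Context: A $\Delta$-matroid is a pair $(E,\mathcal{F})$ with $E$ finite and $\mathcal{F}$ a nonempty collection of subsets of $E$ (feasible sets) such that for all $F_1,F_2\in\mathcal{F}$ and $x\in F_1\Delta F_2$ there is $y\in F_1\Delta F_2$ (possibly $y=x$) with $F_1\Delta\{x,y\}\in\mathcal{F}$; $\Delta$ is symmetric difference. For a symmetric binary matrix $A$ indexed by $E$ and $W\subseteq E$, $A[W]$ is the principal submatrix on $W$ ($A[\emptyset]$ is considered invertible), and $D(A)=(E,\{W : A[W]\text{ invertible over }GF(2)\})$. The twist of $(E,\mathcal{F})$ by $S\subseteq E$ is $(E,\{S\Delta X : X\in\mathcal{F}\})$. A $\Delta$-matroid $D$ is binary if there exist a feasible set $F$ and a symmetric binary matrix $A$ such that $D$ equals the twist of $D(A)$ by $F$. Handle slides: for $a,b\in E$, $a\neq b$, $D_{ab}=(E,\mathcal{F}_{ab})$ with $\mathcal{F}_{ab}=\mathcal{F}\,\Delta\,\{X\cup\{a\} : X\subseteq E\setminus\{a,b\},\ X\cup\{b\}\in\mathcal{F}\}$. -}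

module Defs where

open import Data.Nat using (ℕ; zero; suc; _≤_)
open import Data.Bool using (Bool; true; false; _∧_; _xor_)
open import Data.Fin using (Fin; zero; suc; _≟_)
open import Data.Fin.Subset using (Subset; _∈_; _∉_; _⊆_; _∪_; _─_; ⁅_⁆; ∁; ∣_∣)
open import Data.Vec using (Vec; lookup; zipWith)
open import Data.List using (List; []; _∷_)
open import Data.Product using (Σ; ∃; _×_; _,_)
open import Data.Sum using (_⊎_)
open import Data.Unit using (⊤)
open import Relation.Nullary using (¬_)
open import Relation.Nullary.Decidable using (⌊_⌋)
open import Relation.Binary.PropositionalEquality using (_≡_)

Family : ℕ → Set₁
Family n = Subset n → Set

_Δ_ : ∀ {n} → Subset n → Subset n → Subset n
_Δ_ = zipWith _xor_

_Δᶠ_ : ∀ {n} → Family n → Family n → Family n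
(𝓕 Δᶠ 𝓖) Y = (𝓕 Y × ¬ 𝓖 Y) ⊎ (𝓖 Y × ¬ 𝓕 Y)

IsDeltaMatroid : ∀ {n} → Family n → Set
IsDeltaMatroid {n} 𝓕 =
  (∃ λ F → 𝓕 F) ×
  (∀ (F₁ F₂ : Subset n) (x : Fin n) → 𝓕 F₁ → 𝓕 F₂ → x ∈ (F₁ Δ F₂) →
     ∃ λ (y : Fin n) → y ∈ (F₁ Δ F₂) × 𝓕 (F₁ Δ (⁅ x ⁆ ∪ ⁅ y ⁆)))

Matrix : ℕ → Set
Matrix n = Fin n → Fin n → Bool

Symmetric : ∀ {n} → Matrix n → Set
Symmetric A = ∀ i j → A i j ≡ A j i

Σ₂ : ∀ {n} → (Fin n → Bool) → Bool
Σ₂ {zero}  f = false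
Σ₂ {suc n} f = f zero xor Σ₂ (λ k → f (suc k))

δ : ∀ {n} → Fin n → Fin n → Bool
δ i j = ⌊ i ≟ j ⌋

-- (i,j) entry of the product of the principal submatrices P[W] Q[W]
prodOn : ∀ {n} → Subset n → Matrix n → Matrix n → Fin n → Fin n → Bool
prodOn W P Q i j = Σ₂ (λ k → lookup W k ∧ (P i k ∧ Q k j))

-- A[W] is invertible over GF(2): there is a W×W matrix B[W] with
-- A[W] B[W] = I = B[W] A[W]  (vacuous, hence true, for W = ∅)
InvertibleOn : ∀ {n} → Matrix n → Subset n → Set
InvertibleOn {n} A W = ∃ λ (B : Matrix n) →
  (∀ i j → i ∈ W → j ∈ W → prodOn W A B i j ≡ δ i j) ×
  (∀ i j → i ∈ W → j ∈ W → prodOn W B A i j ≡ δ i j)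

𝓓 : ∀ {n} → Matrix n → Family n
𝓓 A W = InvertibleOn A W

twist : ∀ {n} → Subset n → Family n → Family n
twist S 𝓕 Y = ∃ λ X → 𝓕 X × Y ≡ S Δ X

_≐_ : ∀ {n} → Family n → Family n → Set
𝓕 ≐ 𝓖 = ∀ Y → (𝓕 Y → 𝓖 Y) × (𝓖 Y → 𝓕 Y)

IsBinary : ∀ {n} → Family n → Set
IsBinary {n} 𝓕 = ∃ λ (F : Subset n) → 𝓕 F × ∃ λ (A : Matrix n) →
  Symmetric A × (𝓕 ≐ twist F (𝓓 A))

slideSet : ∀ {n} → Fin n → Fin n → Family n → Family n
slideSet a b 𝓕 Y = ∃ λ X →
  X ⊆ ∁ (⁅ a ⁆ ∪ ⁅ b ⁆) × 𝓕 (X ∪ ⁅ b ⁆) × Y ≡ X ∪ ⁅ a ⁆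

handleSlide : ∀ {n} → Fin n → Fin n → Family n → Family n
handleSlide a b 𝓕 = 𝓕 Δᶠ slideSet a b 𝓕

ValidSlides : ∀ {n} → List (Fin n × Fin n) → Set
ValidSlides [] = ⊤
ValidSlides ((a , b) ∷ s) = ¬ a ≡ b × ValidSlides s

applySlides : ∀ {n} → List (Fin n × Fin n) → Family n → Family n
applySlides []            𝓕 = 𝓕
applySlides ((a , b) ∷ s) 𝓕 = applySlides s (handleSlide a b 𝓕)

UniqueMin : ∀ {n} → Family n → Set
UniqueMin {n} 𝓕 = ∃ λ (F : Subset n) → 𝓕 F ×
  (∀ G → 𝓕 G → ∣ F ∣ ≤ ∣ G ∣) ×
  (∀ G → 𝓕 G → ∣ G ∣ ≤ ∣ F ∣ → G ≡ F)

UniqueMax : ∀ {n} → Family n → Set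
UniqueMax {n} 𝓕 = ∃ λ (F : Subset n) → 𝓕 F ×
  (∀ G → 𝓕 G → ∣ G ∣ ≤ ∣ F ∣) ×
  (∀ G → 𝓕 G → ∣ F ∣ ≤ ∣ G ∣ → G ≡ F)

-- Write the feasible sets of D as the Y for which A[F Δ Y] is nonsingular. A handle slide (a, b)
-- then acts on the matrix alone: if a and b lie on the same side of F it is the congruence adding row
-- and column b to a, and otherwise it toggles the entries A_ab = A_ba. Both facts come from expanding
-- A[W] along a: over GF(2), nonsingularity of a matrix bordered by a column r and a corner s is a
-- linear function of (r, s), so after the slide the indicator of feasibility of Y is the xor of the
-- old indicators of Y and Y Δ {a, b}, which is the handle slide rule.
-- With these two operations, symmetric Gaussian elimination brings A to a normal form N in which every
-- row has at most one nonzero entry and nonzero entries join elements on the same side of F. Then N[W]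
-- is nonsingular iff every element of W has its partner in W, so the feasible sets are the Y with F Δ Y
-- closed under partners: the smallest removes from F its matched elements, the largest adds all matched
-- elements outside F, and the exchange axiom is checked directly.

module Submission where

open import Defs
open import Data.Nat using (ℕ; zero; suc; _^_; _≤_)
open import Data.Nat.Properties using (n<1+n; ≤⇒≯)
open import Data.Fin using (Fin; zero; suc; _≟_; combine; remQuot; punchOut)
open import Data.Fin.Properties using (remQuot-combine; combine-remQuot; punchOut-injective; pigeonhole; any?; all?; ¬∀⟶∃¬; <⇒≢; suc-injective)
open import Data.Fin.Subset using (Subset; _∈_; _⊆_; ∣_∣; _∪_; ⁅_⁆; ∁)
open import Data.Fin.Subset.Properties using (p⊆q⇒∣p∣≤∣q∣; p⊂q⇒∣p∣<∣q∣; ⊆-antisym; _∈?_)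
open import Data.Bool using (Bool; true; false; _∧_; _∨_; _xor_; not; if_then_else_; T)
open import Data.Bool.Properties
  using (∧-assoc; ∧-comm; ∧-identityˡ; ∧-identityʳ; ∧-zeroʳ; ∧-distribˡ-xor; ∨-zeroʳ; ∨-identityʳ; xor-same; xor-comm; xor-identityʳ;
         not-involutive; not-injective; ¬-not; T-∧)
  renaming (_≟_ to _≟ᵇ_)
open import Data.Vec using (lookup; tabulate)
open import Data.Vec.Properties using ([]=⇒lookup; lookup⇒[]=; lookup-zipWith; lookup-map; lookup-replicate; lookup∘tabulate; tabulate∘lookup; tabulate-cong)
open import Data.List using (List; []; _∷_; _++_; allFin)
open import Data.List.Membership.Propositional using () renaming (_∈_ to _∈ˡ_)
open import Data.List.Membership.Propositional.Properties using (∈-allFin)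
open import Data.List.Relation.Unary.Any using (here; there)
open import Data.Product using (Σ; ∃; ∃₂; _×_; _,_; proj₁; proj₂)
open import Data.Sum as Sum using (_⊎_; inj₁; inj₂; [_,_])
open import Data.Unit using (⊤; tt)
open import Data.Empty using (⊥; ⊥-elim)
open import Relation.Nullary using (¬_; Dec; yes; no; does; contradiction)
open import Relation.Nullary.Decidable using (_→-dec_; _×-dec_; _⊎-dec_; ¬?; dec-true)
open import Relation.Nullary.Reflects using (Reflects; ofʸ; ofⁿ; det)
open import Relation.Unary using (Decidable)
open import Relation.Binary.PropositionalEquality using (_≡_; _≢_; _≗_; refl; sym; trans; cong; cong₂; subst; module ≡-Reasoning)
open import Function using (_∘_; id; _⇔_; mk⇔; Equivalence)
import Function.Properties.Equivalence as ⇔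

-- Sums over GF(2)

Bits : ℕ → Set
Bits n = Fin n → Bool

BoolFun : ℕ → Set
BoolFun zero    = Bool
BoolFun (suc n) = Bool → BoolFun n

sameTable : ∀ n → BoolFun n → BoolFun n → Bool
sameTable zero    f g = does (f ≟ᵇ g)
sameTable (suc n) f g = sameTable n (f true) (g true) ∧ sameTable n (f false) (g false)

Pointwise : ∀ n → BoolFun n → BoolFun n → Set
Pointwise zero    f g = f ≡ g
Pointwise (suc n) f g = ∀ b → Pointwise n (f b) (g b)

truth-table : ∀ n (f g : BoolFun n) → T (sameTable n f g) → Pointwise n f g
truth-table zero    f g _ with f ≟ᵇ g
... | yes f≡g = f≡g
truth-table (suc n) f g same true  = truth-table n (f true)  (g true)  (proj₁ (Equivalence.to T-∧ same))
truth-table (suc n) f g same false = truth-table n (f false) (g false) (proj₂ (Equivalence.to T-∧ same))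

Σ₂-cong : ∀ {n} {f g : Bits n} → f ≗ g → Σ₂ f ≡ Σ₂ g
Σ₂-cong {zero}  f≗g = refl
Σ₂-cong {suc n} f≗g = cong₂ _xor_ (f≗g zero) (Σ₂-cong (f≗g ∘ suc))

xor-interchange : ∀ a b c d → (a xor b) xor (c xor d) ≡ (a xor c) xor (b xor d)
xor-interchange = truth-table 4 (λ a b c d → (a xor b) xor (c xor d)) (λ a b c d → (a xor c) xor (b xor d)) _

Σ₂-xor : ∀ {n} (f g : Bits n) → Σ₂ (λ k → f k xor g k) ≡ Σ₂ f xor Σ₂ g
Σ₂-xor {zero}  f g = refl
Σ₂-xor {suc n} f g = trans (cong ((f zero xor g zero) xor_) (Σ₂-xor (f ∘ suc) (g ∘ suc)))
                           (xor-interchange (f zero) (g zero) (Σ₂ (f ∘ suc)) (Σ₂ (g ∘ suc)))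

Σ₂-∧ˡ : ∀ {n} c (f : Bits n) → Σ₂ (λ k → c ∧ f k) ≡ c ∧ Σ₂ f
Σ₂-∧ˡ {zero}  false f = refl
Σ₂-∧ˡ {zero}  true  f = refl
Σ₂-∧ˡ {suc n} c     f = trans (cong ((c ∧ f zero) xor_) (Σ₂-∧ˡ c (f ∘ suc)))
                              (sym (∧-distribˡ-xor c (f zero) (Σ₂ (f ∘ suc))))

Σ₂-∧ʳ : ∀ {n} c (f : Bits n) → Σ₂ (λ k → f k ∧ c) ≡ Σ₂ f ∧ c
Σ₂-∧ʳ c f = trans (Σ₂-cong (λ k → ∧-comm (f k) c)) (trans (Σ₂-∧ˡ c f) (∧-comm c (Σ₂ f)))

Σ₂-zero : ∀ {n} (f : Bits n) → (∀ k → f k ≡ false) → Σ₂ f ≡ false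
Σ₂-zero {zero}  f f≡0 = refl
Σ₂-zero {suc n} f f≡0 rewrite f≡0 zero = Σ₂-zero (f ∘ suc) (f≡0 ∘ suc)

Σ₂-single : ∀ {n} (f : Bits n) j → (∀ k → k ≢ j → f k ≡ false) → Σ₂ f ≡ f j
Σ₂-single {suc n} f zero    off rewrite Σ₂-zero (f ∘ suc) (λ k → off (suc k) (λ ())) = xor-identityʳ (f zero)
Σ₂-single {suc n} f (suc j) off rewrite off zero (λ ()) =
  Σ₂-single (f ∘ suc) j (λ k k≢j → off (suc k) (k≢j ∘ suc-injective))

Σ₂-comm : ∀ {n m} (f : Fin n → Fin m → Bool) → Σ₂ (λ i → Σ₂ (f i)) ≡ Σ₂ (λ j → Σ₂ (λ i → f i j))
Σ₂-comm {zero}  {m} f = sym (Σ₂-zero {m} (λ _ → false) (λ _ → refl))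
Σ₂-comm {suc n}     f = trans (cong (Σ₂ (f zero) xor_) (Σ₂-comm (f ∘ suc)))
                              (sym (Σ₂-xor (f zero) (λ j → Σ₂ (λ i → f (suc i) j))))

δ-refl : ∀ {n} (i : Fin n) → δ i i ≡ true
δ-refl i with i ≟ i
... | yes _   = refl
... | no i≢i = ⊥-elim (i≢i refl)

δ-≢ : ∀ {n} {i j : Fin n} → i ≢ j → δ i j ≡ false
δ-≢ {i = i} {j} i≢j with i ≟ j
... | yes i≡j = ⊥-elim (i≢j i≡j)
... | no _    = refl

Σ₂-δ : ∀ {n} j (f : Bits n) → Σ₂ (λ k → δ k j ∧ f k) ≡ f j
Σ₂-δ j f = trans (Σ₂-single (λ k → δ k j ∧ f k) j (λ k k≢j → cong (_∧ f k) (δ-≢ k≢j)))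
                 (cong (_∧ f j) (δ-refl j))

-- Enumerating bit vectors

encodeBit : Bool → Fin 2
encodeBit false = zero
encodeBit true  = suc zero

decodeBit : Fin 2 → Bool
decodeBit zero       = false
decodeBit (suc zero) = true

encode : ∀ {n} → Bits n → Fin (2 ^ n)
encode {zero}  x = zero
encode {suc n} x = combine (encodeBit (x zero)) (encode (x ∘ suc))

decode : ∀ {n} → Fin (2 ^ n) → Bits n
decodeSplit : ∀ {n} → Fin 2 × Fin (2 ^ n) → Bits (suc n)
decode {suc n} c = decodeSplit (remQuot {2} (2 ^ n) c)
decodeSplit (h , t) zero    = decodeBit h
decodeSplit (h , t) (suc k) = decode t k

decode-encode : ∀ {n} (x : Bits n) → decode (encode x) ≗ x
decode-encode {suc n} x k =
  trans (cong (λ p → decodeSplit p k) (remQuot-combine {2} {2 ^ n} (encodeBit (x zero)) (encode (x ∘ suc)))) (lemma k)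
  where
    lemma : ∀ k → decodeSplit (encodeBit (x zero) , encode (x ∘ suc)) k ≡ x k
    lemma zero    with x zero
    ... | false = refl
    ... | true  = refl
    lemma (suc k) = decode-encode (x ∘ suc) k

encode-cong : ∀ {n} {x y : Bits n} → x ≗ y → encode x ≡ encode y
encode-cong {zero}  x≗y = refl
encode-cong {suc n} x≗y = cong₂ combine (cong encodeBit (x≗y zero)) (encode-cong (x≗y ∘ suc))

encode-decode : ∀ {n} (c : Fin (2 ^ n)) → encode (decode {n} c) ≡ c
encode-decode {zero}  zero = refl
encode-decode {suc n} c    =
  trans (cong₂ combine (lemma (proj₁ (remQuot {2} (2 ^ n) c))) (encode-decode {n} (proj₂ (remQuot {2} (2 ^ n) c))))
        (combine-remQuot {2} (2 ^ n) c)
  where lemma : ∀ d → encodeBit (decodeBit d) ≡ d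
        lemma zero       = refl
        lemma (suc zero) = refl

-- If t were missed, punching it out of the codomain would give an injection Fin (suc N) → Fin N.
Fin-injective⇒surjective : ∀ {N} (g : Fin N → Fin N) → (∀ i j → g i ≡ g j → i ≡ j) → ∀ t → ∃ λ c → g c ≡ t
Fin-injective⇒surjective {suc N} g inj t with any? (λ c → g c ≟ t)
... | yes hit = hit
... | no miss with pigeonhole (n<1+n N) (λ c → punchOut {i = t} (λ t≡gc → miss (c , sym t≡gc)))
... | i , j , i<j , same = ⊥-elim (<⇒≢ i<j (inj i j (punchOut-injective {i = t} _ _ same)))

Bits-injective⇒surjective : ∀ {n} (f : Bits n → Bits n) →
  (∀ {x y} → x ≗ y → f x ≗ f y) → (∀ x y → f x ≗ f y → x ≗ y) → ∀ v → ∃ λ x → f x ≗ v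
Bits-injective⇒surjective {n} f f-cong f-inj v
  with Fin-injective⇒surjective f′ f′-inj (encode v)
  where
    f′ : Fin (2 ^ n) → Fin (2 ^ n)
    f′ = encode ∘ f ∘ decode
    decode-f′ : ∀ c → decode (f′ c) ≗ f (decode c)
    decode-f′ c = decode-encode (f (decode c))
    f′-inj : ∀ i j → f′ i ≡ f′ j → i ≡ j
    f′-inj i j eq = trans (sym (encode-decode {n} i)) (trans (encode-cong (f-inj (decode i) (decode j)
      (λ k → trans (sym (decode-f′ i k)) (trans (cong (λ c → decode c k) eq) (decode-f′ j k))))) (encode-decode {n} j))
... | c , f′c≡v = decode c , λ k → trans (sym (decode-encode (f (decode c)) k))
                                        (trans (cong (λ c → decode c k) f′c≡v) (decode-encode v k))

module _ {n} (P : Bits n → Set) (P-resp : ∀ {x y} → x ≗ y → P x → P y) (P? : ∀ x → Dec (P x)) where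

  all-Bits? : Dec (∀ x → P x)
  all-Bits? with all? (P? ∘ decode)
  ... | yes all = yes (λ x → P-resp (decode-encode x) (all (encode x)))
  ... | no ¬all = no (λ all → ¬all (all ∘ decode))

  ¬all-Bits⇒counterexample : ¬ (∀ x → P x) → ∃ λ x → ¬ P x
  ¬all-Bits⇒counterexample ¬all with ¬∀⟶∃¬ (2 ^ n) (P ∘ decode) (P? ∘ decode) (λ all → ¬all (λ x → P-resp (decode-encode x) (all (encode x))))
  ... | c , ¬Pc = decode c , ¬Pc

-- Kernels and invertibility

bit-conflict : ∀ {b} → b ≡ true → b ≡ false → ⊥
bit-conflict refl ()

≢true⇒≡false : ∀ {b} → b ≢ true → b ≡ false
≢true⇒≡false {false} _  = refl
≢true⇒≡false {true}  ≢t = ⊥-elim (≢t refl)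

xor≡false⇒≡ : ∀ {a b} → a xor b ≡ false → a ≡ b
xor≡false⇒≡ {false} {false} _ = refl
xor≡false⇒≡ {true}  {true}  _ = refl

≡⇒xor≡false : ∀ {a b} → a ≡ b → a xor b ≡ false
≡⇒xor≡false {a} refl = xor-same a

lookup-∈ : ∀ {n} {W : Subset n} {i} → i ∈ W → lookup W i ≡ true
lookup-∈ = []=⇒lookup

∈-lookup : ∀ {n} {W : Subset n} {i} → lookup W i ≡ true → i ∈ W
∈-lookup {W = W} {i} = lookup⇒[]= i W

_⊕_ : ∀ {n} → Bits n → Bits n → Bits n
(x ⊕ y) k = x k xor y k

_∩_ : ∀ {n} → Bits n → Bits n → Bits n
(w ∩ x) k = w k ∧ x k

_⊆ᵇ_ : ∀ {n} → Bits n → Bits n → Set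
x ⊆ᵇ w = ∀ k → x k ≡ true → w k ≡ true

IsZero : ∀ {n} → Bits n → Set
IsZero x = ∀ k → x k ≡ false

dot : ∀ {n} → Bits n → Bits n → Bool
dot r x = Σ₂ (λ k → r k ∧ x k)

_·_ : ∀ {n} → Matrix n → Bits n → Bits n
(A · x) i = dot (A i) x

KernelOn : ∀ {n} → Matrix n → Bits n → Bits n → Set
KernelOn A w x = x ⊆ᵇ w × (∀ i → w i ≡ true → (A · x) i ≡ false)

NonsingularOn : ∀ {n} → Matrix n → Bits n → Set
NonsingularOn A w = ∀ x → KernelOn A w x → IsZero x

∩-⊆ᵇ : ∀ {n} (w x : Bits n) → (w ∩ x) ⊆ᵇ w
∩-⊆ᵇ w x k w∧x with w k
... | true  = refl
... | false = w∧x

⊕-⊆ᵇ : ∀ {n} {x y w : Bits n} → x ⊆ᵇ w → y ⊆ᵇ w → (x ⊕ y) ⊆ᵇ w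
⊕-⊆ᵇ {x = x} x⊆w y⊆w k x⊕y with x k in xk
... | true  = x⊆w k xk
... | false = y⊆w k x⊕y

dot-cong : ∀ {n} {r r′ x x′ : Bits n} → r ≗ r′ → x ≗ x′ → dot r x ≡ dot r′ x′
dot-cong r≗r′ x≗x′ = Σ₂-cong (λ k → cong₂ _∧_ (r≗r′ k) (x≗x′ k))

dot-onSupport : ∀ {n} {r r′ x : Bits n} → (∀ k → x k ≡ true → r k ≡ r′ k) → dot r x ≡ dot r′ x
dot-onSupport {r = r} {r′} {x} agree = Σ₂-cong term
  where
    term : ∀ k → r k ∧ x k ≡ r′ k ∧ x k
    term k with x k in xk
    ... | false = trans (∧-zeroʳ _) (sym (∧-zeroʳ _))
    ... | true  = cong (_∧ true) (agree k xk)

dot-⊕ˡ : ∀ {n} (r₁ r₂ x : Bits n) → dot (r₁ ⊕ r₂) x ≡ dot r₁ x xor dot r₂ x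
dot-⊕ˡ r₁ r₂ x = trans (Σ₂-cong (λ k → truth-table 3 (λ a b c → (a xor b) ∧ c) (λ a b c → (a ∧ c) xor (b ∧ c)) _ (r₁ k) (r₂ k) (x k)))
                       (Σ₂-xor (λ k → r₁ k ∧ x k) (λ k → r₂ k ∧ x k))

dot-⊕ʳ : ∀ {n} (r x y : Bits n) → dot r (x ⊕ y) ≡ dot r x xor dot r y
dot-⊕ʳ r x y = trans (Σ₂-cong (λ k → ∧-distribˡ-xor (r k) (x k) (y k))) (Σ₂-xor (λ k → r k ∧ x k) (λ k → r k ∧ y k))

·-cong : ∀ {n} (A : Matrix n) {x y : Bits n} → x ≗ y → A · x ≗ A · y
·-cong A x≗y i = dot-cong {r = A i} (λ _ → refl) x≗y

·-⊕ : ∀ {n} (A : Matrix n) (x y : Bits n) → A · (x ⊕ y) ≗ (A · x) ⊕ (A · y)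
·-⊕ A x y i = dot-⊕ʳ (A i) x y

⊆ᵇ? : ∀ {n} (x w : Bits n) → Dec (x ⊆ᵇ w)
⊆ᵇ? x w = all? (λ k → (x k ≟ᵇ true) →-dec (w k ≟ᵇ true))

IsZero? : ∀ {n} (x : Bits n) → Dec (IsZero x)
IsZero? x = all? (λ k → x k ≟ᵇ false)

KernelOn? : ∀ {n} (A : Matrix n) (w x : Bits n) → Dec (KernelOn A w x)
KernelOn? A w x = ⊆ᵇ? x w ×-dec all? (λ i → (w i ≟ᵇ true) →-dec ((A · x) i ≟ᵇ false))

KernelOn-resp : ∀ {n} (A : Matrix n) w {x y} → x ≗ y → KernelOn A w x → KernelOn A w y
KernelOn-resp A w x≗y (x⊆w , Ax≡0) = (λ k yk → x⊆w k (trans (x≗y k) yk)) , λ i wi → trans (sym (·-cong A x≗y i)) (Ax≡0 i wi)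

KernelOn-⊕ : ∀ {n} (A : Matrix n) w {x y} → KernelOn A w x → KernelOn A w y → KernelOn A w (x ⊕ y)
KernelOn-⊕ A w {x} {y} (x⊆w , Ax≡0) (y⊆w , Ay≡0) =
  ⊕-⊆ᵇ x⊆w y⊆w , λ i wi → trans (·-⊕ A x y i) (cong₂ _xor_ (Ax≡0 i wi) (Ay≡0 i wi))

module _ {n} (A : Matrix n) (w : Bits n) where

  private
    Trivial : Bits n → Set
    Trivial x = KernelOn A w x → IsZero x

    Trivial-resp : ∀ {x y} → x ≗ y → Trivial x → Trivial y
    Trivial-resp x≗y triv ker k = trans (sym (x≗y k)) (triv (KernelOn-resp A w (sym ∘ x≗y) ker) k)

  NonsingularOn? : Dec (NonsingularOn A w)
  NonsingularOn? = all-Bits? Trivial Trivial-resp (λ x → KernelOn? A w x →-dec IsZero? x)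

  singular⇒kernelVector : ¬ NonsingularOn A w → ∃ λ x → KernelOn A w x × ∃ λ k → x k ≡ true
  singular⇒kernelVector singular
    with ¬all-Bits⇒counterexample Trivial Trivial-resp (λ x → KernelOn? A w x →-dec IsZero? x) singular
  ... | x , ¬triv with KernelOn? A w x | IsZero? x
  ... | no ¬ker | _        = ⊥-elim (¬triv (⊥-elim ∘ ¬ker))
  ... | yes _   | yes x≡0  = ⊥-elim (¬triv (λ _ → x≡0))
  ... | yes ker | no ¬zero with ¬∀⟶∃¬ n (λ k → x k ≡ false) (λ k → x k ≟ᵇ false) ¬zero
  ... | k , xk≢false = x , ker , k , lemma
    where
      lemma : x k ≡ true
      lemma with x k
      ... | true  = refl
      ... | false = ⊥-elim (xk≢false refl)

∩-⊆ᵇ-≗ : ∀ {n} {x w : Bits n} → x ⊆ᵇ w → (w ∩ x) ≗ x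
∩-⊆ᵇ-≗ {x = x} {w} x⊆w k with x k in xk
... | true  = trans (cong (_∧ true) (x⊆w k xk)) refl
... | false = ∧-zeroʳ (w k)

NonsingularOn-cong : ∀ {n} {A B : Matrix n} {w v : Bits n} → w ≗ v →
  (∀ i j → w i ≡ true → w j ≡ true → A i j ≡ B i j) → NonsingularOn A w → NonsingularOn B v
NonsingularOn-cong {A = A} {B} {w} {v} w≗v A≡B nonsingular x (x⊆v , Bx≡0) =
  nonsingular x ((λ k xk → trans (w≗v k) (x⊆v k xk)) ,
                 λ i wi → trans (dot-onSupport (λ k xk → A≡B i k wi (trans (w≗v k) (x⊆v k xk)))) (Bx≡0 i (trans (sym (w≗v i)) wi)))

module _ {n} (A : Matrix n) (w : Bits n) (nonsingular : NonsingularOn A w) where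

  private
    -- x ↦ A (w ∩ x) on w and the identity off w: injective when A[w] is nonsingular, hence onto.
    extend : Bits n → Bits n
    extend x i = if w i then (A · (w ∩ x)) i else x i

    extend-on : ∀ x {i} → w i ≡ true → extend x i ≡ (A · (w ∩ x)) i
    extend-on x wi rewrite wi = refl

    extend-off : ∀ x {i} → w i ≡ false → extend x i ≡ x i
    extend-off x wi rewrite wi = refl

    extend-cong : ∀ {x y} → x ≗ y → extend x ≗ extend y
    extend-cong x≗y i with w i
    ... | true  = ·-cong A (λ k → cong (w k ∧_) (x≗y k)) i
    ... | false = x≗y i

    extend-injective : ∀ x y → extend x ≗ extend y → x ≗ y
    extend-injective x y same i with w i in wi
    ... | false = trans (sym (extend-off x wi)) (trans (same i) (extend-off y wi))
    ... | true  = xor≡false⇒≡ (trans (sym (∧-identityˡ _)) (trans (cong (_∧ (x i xor y i)) (sym wi)) (nonsingular d d∈ker i)))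
      where
        d : Bits n
        d = w ∩ (x ⊕ y)
        d∈ker : KernelOn A w d
        d∈ker = ∩-⊆ᵇ w (x ⊕ y) , λ j wj → begin
          (A · d) j                                  ≡⟨ ·-cong A (λ l → ∧-distribˡ-xor (w l) (x l) (y l)) j ⟩
          (A · ((w ∩ x) ⊕ (w ∩ y))) j                ≡⟨ ·-⊕ A (w ∩ x) (w ∩ y) j ⟩
          (A · (w ∩ x)) j xor (A · (w ∩ y)) j        ≡⟨ cong₂ _xor_ (sym (extend-on x wj)) (sym (extend-on y wj)) ⟩
          extend x j xor extend y j                  ≡⟨ ≡⇒xor≡false (same j) ⟩
          false                                      ∎
          where open ≡-Reasoning

  nonsingular⇒solvable : ∀ v → ∃ λ y → y ⊆ᵇ w × (∀ i → w i ≡ true → (A · y) i ≡ v i)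
  nonsingular⇒solvable v with Bits-injective⇒surjective extend extend-cong extend-injective (w ∩ v)
  ... | x , extend-x≗w∩v = w ∩ x , ∩-⊆ᵇ w x ,
        λ i wi → trans (sym (extend-on x wi)) (trans (extend-x≗w∩v i) (cong (_∧ v i) wi))

module _ {n} (W : Subset n) where

  private
    w : Bits n
    w = lookup W

  prodOn-column : ∀ (P Q : Matrix n) i j → prodOn W P Q i j ≡ (P · (λ l → w l ∧ Q l j)) i
  prodOn-column P Q i j = Σ₂-cong (λ l → truth-table 3 (λ a p q → a ∧ (p ∧ q)) (λ a p q → p ∧ (a ∧ q)) _ (w l) (P i l) (Q l j))

  prodOn-congˡ : ∀ (P P′ Q : Matrix n) i j → (∀ l → w l ≡ true → P i l ≡ P′ i l) →
    prodOn W P Q i j ≡ prodOn W P′ Q i j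
  prodOn-congˡ P P′ Q i j agree = Σ₂-cong term
    where
      term : ∀ l → w l ∧ (P i l ∧ Q l j) ≡ w l ∧ (P′ i l ∧ Q l j)
      term l with w l in wl
      ... | false = refl
      ... | true  = cong (λ p → true ∧ (p ∧ Q l j)) (agree l wl)

  prodOn-⊕ʳ : ∀ (P Q R : Matrix n) i j → prodOn W P (λ l k → Q l k xor R l k) i j ≡ prodOn W P Q i j xor prodOn W P R i j
  prodOn-⊕ʳ P Q R i j = trans (Σ₂-cong (λ l → truth-table 4 (λ a b c d → a ∧ (b ∧ (c xor d))) (λ a b c d → (a ∧ (b ∧ c)) xor (a ∧ (b ∧ d))) _
                                                         (w l) (P i l) (Q l j) (R l j)))
                              (Σ₂-xor (λ l → w l ∧ (P i l ∧ Q l j)) (λ l → w l ∧ (P i l ∧ R l j)))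

  prodOn-zeroʳ : ∀ (P Q : Matrix n) i j → (∀ l → w l ≡ true → Q l j ≡ false) → prodOn W P Q i j ≡ false
  prodOn-zeroʳ P Q i j col≡0 = Σ₂-zero _ term
    where
      term : ∀ l → w l ∧ (P i l ∧ Q l j) ≡ false
      term l with w l in wl
      ... | false = refl
      ... | true  = trans (cong (P i l ∧_) (col≡0 l wl)) (∧-zeroʳ _)

  prodOn-identityˡ : ∀ (Q : Matrix n) i j → w i ≡ true → prodOn W δ Q i j ≡ Q i j
  prodOn-identityˡ Q i j wi =
    trans (Σ₂-single _ i (λ l l≢i → trans (cong (λ d → w l ∧ (d ∧ Q l j)) (δ-≢ (l≢i ∘ sym))) (∧-zeroʳ _)))
          (cong₂ (λ a d → a ∧ (d ∧ Q i j)) wi (δ-refl i))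

  prodOn-identityʳ : ∀ (P : Matrix n) i j → w j ≡ true → prodOn W P δ i j ≡ P i j
  prodOn-identityʳ P i j wj =
    trans (Σ₂-single _ j (λ l l≢j → trans (cong (λ d → w l ∧ (P i l ∧ d)) (δ-≢ l≢j)) (truth-table 2 (λ a p → a ∧ (p ∧ false)) (λ _ _ → false) _ (w l) (P i l))))
          (trans (cong₂ (λ a d → a ∧ (P i j ∧ d)) wj (δ-refl j)) (∧-identityʳ (P i j)))

  prodOn-assoc : ∀ (P Q R : Matrix n) i j → prodOn W P (prodOn W Q R) i j ≡ prodOn W (prodOn W P Q) R i j
  prodOn-assoc P Q R i j = begin
    Σ₂ (λ m → w m ∧ (P i m ∧ Σ₂ (λ l → w l ∧ (Q m l ∧ R l j))))
      ≡⟨ Σ₂-cong (λ m → trans (sym (∧-assoc (w m) (P i m) _)) (sym (Σ₂-∧ˡ (w m ∧ P i m) (λ l → w l ∧ (Q m l ∧ R l j))))) ⟩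
    Σ₂ (λ m → Σ₂ (λ l → (w m ∧ P i m) ∧ (w l ∧ (Q m l ∧ R l j))))
      ≡⟨ Σ₂-cong (λ m → Σ₂-cong (λ l → shuffle (w m) (P i m) (w l) (Q m l) (R l j))) ⟩
    Σ₂ (λ m → Σ₂ (λ l → w l ∧ ((w m ∧ (P i m ∧ Q m l)) ∧ R l j)))
      ≡⟨ Σ₂-comm (λ m l → w l ∧ ((w m ∧ (P i m ∧ Q m l)) ∧ R l j)) ⟩
    Σ₂ (λ l → Σ₂ (λ m → w l ∧ ((w m ∧ (P i m ∧ Q m l)) ∧ R l j)))
      ≡⟨ Σ₂-cong (λ l → trans (Σ₂-∧ˡ (w l) (λ m → (w m ∧ (P i m ∧ Q m l)) ∧ R l j)) (cong (w l ∧_) (Σ₂-∧ʳ (R l j) (λ m → w m ∧ (P i m ∧ Q m l))))) ⟩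
    Σ₂ (λ l → w l ∧ (prodOn W P Q i l ∧ R l j))
      ∎
    where
      open ≡-Reasoning
      shuffle : ∀ a b c d e → (a ∧ b) ∧ (c ∧ (d ∧ e)) ≡ c ∧ ((a ∧ (b ∧ d)) ∧ e)
      shuffle = truth-table 5 (λ a b c d e → (a ∧ b) ∧ (c ∧ (d ∧ e))) (λ a b c d e → c ∧ ((a ∧ (b ∧ d)) ∧ e)) _

invertible⇒nonsingular : ∀ {n} (A : Matrix n) (W : Subset n) → InvertibleOn A W → NonsingularOn A (lookup W)
invertible⇒nonsingular {n} A W (B , _ , BA≡I) x (x⊆w , Ax≡0) j with lookup W j in wj
... | false = ≢true⇒≡false (λ xj → bit-conflict (x⊆w j xj) wj)
... | true  = begin
  x j                               ≡⟨ sym (prodOn-identityˡ W X j j wj) ⟩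
  prodOn W δ X j j                  ≡⟨ sym (prodOn-congˡ W (prodOn W B A) δ X j j (λ l wl → BA≡I j l (∈-lookup wj) (∈-lookup wl))) ⟩
  prodOn W (prodOn W B A) X j j     ≡⟨ sym (prodOn-assoc W B A X j j) ⟩
  prodOn W B (prodOn W A X) j j     ≡⟨ prodOn-zeroʳ W B (prodOn W A X) j j AX≡0 ⟩
  false                             ∎
  where
    open ≡-Reasoning
    X : Matrix n
    X l _ = x l
    AX≡0 : ∀ m → lookup W m ≡ true → prodOn W A X m j ≡ false
    AX≡0 m wm = trans (prodOn-column W A X m j) (trans (·-cong A (∩-⊆ᵇ-≗ x⊆w) m) (Ax≡0 m wm))

nonsingular⇒invertible : ∀ {n} (A : Matrix n) (W : Subset n) → NonsingularOn A (lookup W) → InvertibleOn A W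
nonsingular⇒invertible {n} A W nonsingular = B , (λ i j iW _ → AB≡I i j (lookup-∈ iW)) , BA≡I
  where
    w : Bits n
    w = lookup W
    column : ∀ j → ∃ λ y → y ⊆ᵇ w × (∀ i → w i ≡ true → (A · y) i ≡ δ i j)
    column j = nonsingular⇒solvable A w nonsingular (λ i → δ i j)
    B : Matrix n
    B k j = proj₁ (column j) k
    AB≡I : ∀ i j → w i ≡ true → prodOn W A B i j ≡ δ i j
    AB≡I i j wi = trans (prodOn-column W A B i j)
                        (trans (·-cong A (∩-⊆ᵇ-≗ (proj₁ (proj₂ (column j)))) i) (proj₂ (proj₂ (column j)) i wi))
    BA≡I : ∀ i j → i ∈ W → j ∈ W → prodOn W B A i j ≡ δ i j
    BA≡I i j iW jW = xor≡false⇒≡ (trans (sym (∧-identityˡ _)) (trans (cong (_∧ C i j) (sym (lookup-∈ iW))) (nonsingular c c∈ker i)))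
      where
        open ≡-Reasoning
        C : Matrix n
        C m k = prodOn W B A m k xor δ m k
        c : Bits n
        c m = w m ∧ C m j
        c∈ker : KernelOn A w c
        c∈ker = ∩-⊆ᵇ w (λ m → C m j) , λ i wi → begin
          (A · c) i                                             ≡⟨ sym (prodOn-column W A C i j) ⟩
          prodOn W A C i j                                      ≡⟨ prodOn-⊕ʳ W A (prodOn W B A) δ i j ⟩
          prodOn W A (prodOn W B A) i j xor prodOn W A δ i j    ≡⟨ cong₂ _xor_ (prodOn-assoc W A B A i j) (prodOn-identityʳ W A i j (lookup-∈ jW)) ⟩
          prodOn W (prodOn W A B) A i j xor A i j               ≡⟨ cong (_xor A i j) (prodOn-congˡ W (prodOn W A B) δ A i j (λ l _ → AB≡I i l wi)) ⟩
          prodOn W δ A i j xor A i j                            ≡⟨ cong (_xor A i j) (prodOn-identityˡ W A i j wi) ⟩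
          A i j xor A i j                                       ≡⟨ xor-same (A i j) ⟩
          false                                                 ∎

-- Bordered matrices

reflects : ∀ {P : Set} {b} → (P → b ≡ true) → (b ≡ true → P) → Reflects P b
reflects {b = true}  _     from = ofʸ (from refl)
reflects {b = false} sound _    = ofⁿ (λ p → bit-conflict (sound p) refl)

Reflects-⇔ : ∀ {P Q : Set} {b} → P ⇔ Q → Reflects Q b → Reflects P b
Reflects-⇔ P⇔Q (ofʸ q)  = ofʸ (Equivalence.from P⇔Q q)
Reflects-⇔ P⇔Q (ofⁿ ¬q) = ofⁿ (¬q ∘ Equivalence.to P⇔Q)

XorReflected : Set → Set → Set → Set
XorReflected P Q R = ∃₂ λ p q → Reflects P p × Reflects Q q × Reflects R (p xor q)

XorReflected⇒⇔ : ∀ {P Q R : Set} → XorReflected P Q R → R ⇔ ((P × ¬ Q) ⊎ (Q × ¬ P))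
XorReflected⇒⇔ (_ , _ , ofʸ P  , ofʸ Q  , ofⁿ ¬R) = mk⇔ (⊥-elim ∘ ¬R) λ { (inj₁ (_ , ¬Q)) → ⊥-elim (¬Q Q) ; (inj₂ (_ , ¬P)) → ⊥-elim (¬P P) }
XorReflected⇒⇔ (_ , _ , ofʸ P  , ofⁿ ¬Q , ofʸ R)  = mk⇔ (λ _ → inj₁ (P , ¬Q)) (λ _ → R)
XorReflected⇒⇔ (_ , _ , ofⁿ ¬P , ofʸ Q  , ofʸ R)  = mk⇔ (λ _ → inj₂ (Q , ¬P)) (λ _ → R)
XorReflected⇒⇔ (_ , _ , ofⁿ ¬P , ofⁿ ¬Q , ofⁿ ¬R) = mk⇔ (⊥-elim ∘ ¬R) λ { (inj₁ (P , _)) → ⊥-elim (¬P P) ; (inj₂ (Q , _)) → ⊥-elim (¬Q Q) }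

dot-comm : ∀ {n} (x y : Bits n) → dot x y ≡ dot y x
dot-comm x y = Σ₂-cong (λ k → ∧-comm (x k) (y k))

dot-·-sym : ∀ {n} (A : Matrix n) → Symmetric A → ∀ x y → dot (A · x) y ≡ dot x (A · y)
dot-·-sym A A-sym x y = begin
  Σ₂ (λ k → (A · x) k ∧ y k)                    ≡⟨ Σ₂-cong (λ k → sym (Σ₂-∧ʳ (y k) (λ l → A k l ∧ x l))) ⟩
  Σ₂ (λ k → Σ₂ (λ l → (A k l ∧ x l) ∧ y k))     ≡⟨ Σ₂-comm (λ k l → (A k l ∧ x l) ∧ y k) ⟩
  Σ₂ (λ l → Σ₂ (λ k → (A k l ∧ x l) ∧ y k))     ≡⟨ Σ₂-cong (λ l → Σ₂-cong (λ k → term l k)) ⟩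
  Σ₂ (λ l → Σ₂ (λ k → x l ∧ (A l k ∧ y k)))     ≡⟨ Σ₂-cong (λ l → Σ₂-∧ˡ (x l) (λ k → A l k ∧ y k)) ⟩
  Σ₂ (λ l → x l ∧ (A · y) l)                    ∎
  where
    open ≡-Reasoning
    term : ∀ l k → (A k l ∧ x l) ∧ y k ≡ x l ∧ (A l k ∧ y k)
    term l k rewrite A-sym k l = truth-table 3 (λ a b c → (a ∧ b) ∧ c) (λ a b c → b ∧ (a ∧ c)) _ (A l k) (x l) (y k)

dot-vanishing : ∀ {n} {x v u : Bits n} → x ⊆ᵇ u → (∀ i → u i ≡ true → v i ≡ false) → dot x v ≡ false
dot-vanishing {n} {x = x} {v} x⊆u v≡0 =
  trans (dot-comm x v) (trans (dot-onSupport {r′ = λ _ → false} (λ k xk → v≡0 k (x⊆u k xk))) (Σ₂-zero {n} (λ _ → false) (λ _ → refl)))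

-- (x , t) is a kernel vector of the bordered matrix [[A[u], r], [rᵀ, s]], t being its last coordinate.
BorderedKernel : ∀ {n} → Matrix n → Bits n → Bits n → Bool → Bits n → Bool → Set
BorderedKernel A u r s x t =
  x ⊆ᵇ u × (∀ i → u i ≡ true → (t ∧ r i) xor (A · x) i ≡ false) × ((t ∧ s) xor dot r x ≡ false)

BorderedNonsingular : ∀ {n} → Matrix n → Bits n → Bits n → Bool → Set
BorderedNonsingular A u r s = ∀ x t → BorderedKernel A u r s x t → t ≡ false × IsZero x

BorderedNonsingular-cong : ∀ {n} {A A′ : Matrix n} {u u′ r r′ : Bits n} {s s′ : Bool} → u ≗ u′ →
  (∀ i j → u i ≡ true → u j ≡ true → A i j ≡ A′ i j) → (∀ i → u i ≡ true → r i ≡ r′ i) → s ≡ s′ →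
  BorderedNonsingular A u r s → BorderedNonsingular A′ u′ r′ s′
BorderedNonsingular-cong {A = A} {A′} {u} {u′} {r} {r′} {s} u≗u′ A≡A′ r≡r′ refl nonsingular x t (x⊆u′ , border , corner) =
  nonsingular x t (x⊆u , (λ i ui → trans (cong₂ _xor_ (cong (t ∧_) (r≡r′ i ui)) (dot-onSupport (λ k xk → A≡A′ i k ui (x⊆u k xk))))
                                         (border i (trans (sym (u≗u′ i)) ui))) ,
                   trans (cong ((t ∧ s) xor_) (dot-onSupport (λ k xk → r≡r′ k (x⊆u k xk)))) corner)
  where
    x⊆u : x ⊆ᵇ u
    x⊆u k xk = trans (u≗u′ k) (x⊆u′ k xk)

module Regular {n} (A : Matrix n) (A-sym : Symmetric A) (u : Bits n) (nonsingular : NonsingularOn A u) where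

  Solves : Bits n → Bits n → Set
  Solves r y = y ⊆ᵇ u × (∀ i → u i ≡ true → (A · y) i ≡ r i)

  reflects-solution : ∀ r s y → Solves r y → Reflects (BorderedNonsingular A u r s) (s xor dot r y)
  reflects-solution r s y (y⊆u , Ay≡r) = reflects sound complete
    where
      sound : BorderedNonsingular A u r s → s xor dot r y ≡ true
      sound bordered with s xor dot r y in κ
      ... | true  = refl
      ... | false = ⊥-elim (bit-conflict refl (proj₁ (bordered y true (y⊆u , (λ i ui → ≡⇒xor≡false (sym (Ay≡r i ui))) , κ))))
      complete : s xor dot r y ≡ true → BorderedNonsingular A u r s
      complete κ x false (x⊆u , Ax≡0 , _)      = refl , nonsingular x (x⊆u , Ax≡0)
      complete κ x true  (x⊆u , Ax≡r , rx≡s) = ⊥-elim (bit-conflict κ (trans (cong (s xor_) (dot-cong {r = r} (λ _ → refl) y≗x)) rx≡s))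
        where
          x⊕y∈ker : KernelOn A u (x ⊕ y)
          x⊕y∈ker = ⊕-⊆ᵇ x⊆u y⊆u , λ i ui →
            trans (·-⊕ A x y i) (trans (cong ((A · x) i xor_) (Ay≡r i ui)) (trans (xor-comm _ (r i)) (Ax≡r i ui)))
          y≗x : y ≗ x
          y≗x k = sym (xor≡false⇒≡ (nonsingular (x ⊕ y) x⊕y∈ker k))

  solution : ∀ r → ∃ (Solves r)
  solution = nonsingular⇒solvable A u nonsingular

  κ : Bits n → Bool → Bool
  κ r s = s xor dot r (proj₁ (solution r))

  κ-reflects : ∀ r s → Reflects (BorderedNonsingular A u r s) (κ r s)
  κ-reflects r s = reflects-solution r s _ (proj₂ (solution r))

  cross-term : ∀ r₁ r₂ y₁ y₂ → Solves r₁ y₁ → Solves r₂ y₂ → dot r₁ y₂ ≡ dot r₂ y₁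
  cross-term r₁ r₂ y₁ y₂ (y₁⊆u , Ay₁≡r₁) (y₂⊆u , Ay₂≡r₂) = begin
    dot r₁ y₂          ≡⟨ dot-onSupport (λ k y₂k → sym (Ay₁≡r₁ k (y₂⊆u k y₂k))) ⟩
    dot (A · y₁) y₂    ≡⟨ dot-·-sym A A-sym y₁ y₂ ⟩
    dot y₁ (A · y₂)    ≡⟨ dot-comm y₁ (A · y₂) ⟩
    dot (A · y₂) y₁    ≡⟨ dot-onSupport (λ k y₁k → Ay₂≡r₂ k (y₁⊆u k y₁k)) ⟩
    dot r₂ y₁          ∎
    where open ≡-Reasoning

  κ-linear : ∀ r₁ s₁ r₂ s₂ → κ (r₁ ⊕ r₂) (s₁ xor s₂) ≡ κ r₁ s₁ xor κ r₂ s₂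
  κ-linear r₁ s₁ r₂ s₂ = trans (det (κ-reflects (r₁ ⊕ r₂) (s₁ xor s₂)) (reflects-solution (r₁ ⊕ r₂) (s₁ xor s₂) (y₁ ⊕ y₂) sol₁₂)) expand
    where
      open ≡-Reasoning
      y₁ : Bits n
      y₁ = proj₁ (solution r₁)
      y₂ : Bits n
      y₂ = proj₁ (solution r₂)
      sol₁ : Solves r₁ y₁
      sol₁ = proj₂ (solution r₁)
      sol₂ : Solves r₂ y₂
      sol₂ = proj₂ (solution r₂)
      sol₁₂ : Solves (r₁ ⊕ r₂) (y₁ ⊕ y₂)
      sol₁₂ = ⊕-⊆ᵇ (proj₁ sol₁) (proj₁ sol₂) , λ i ui → trans (·-⊕ A y₁ y₂ i) (cong₂ _xor_ (proj₂ sol₁ i ui) (proj₂ sol₂ i ui))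
      expand : (s₁ xor s₂) xor dot (r₁ ⊕ r₂) (y₁ ⊕ y₂) ≡ κ r₁ s₁ xor κ r₂ s₂
      expand = begin
        (s₁ xor s₂) xor dot (r₁ ⊕ r₂) (y₁ ⊕ y₂)
          ≡⟨ cong ((s₁ xor s₂) xor_) (trans (dot-⊕ˡ r₁ r₂ (y₁ ⊕ y₂)) (cong₂ _xor_ (dot-⊕ʳ r₁ y₁ y₂) (dot-⊕ʳ r₂ y₁ y₂))) ⟩
        (s₁ xor s₂) xor ((dot r₁ y₁ xor dot r₁ y₂) xor (dot r₂ y₁ xor dot r₂ y₂))
          ≡⟨ cong (λ c → (s₁ xor s₂) xor ((dot r₁ y₁ xor c) xor (dot r₂ y₁ xor dot r₂ y₂))) (cross-term r₁ r₂ y₁ y₂ sol₁ sol₂) ⟩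
        (s₁ xor s₂) xor ((dot r₁ y₁ xor dot r₂ y₁) xor (dot r₂ y₁ xor dot r₂ y₂))
          ≡⟨ truth-table 5 (λ p q a c b → (p xor q) xor ((a xor c) xor (c xor b))) (λ p q a c b → (p xor a) xor (q xor b)) _
                           s₁ s₂ (dot r₁ y₁) (dot r₂ y₁) (dot r₂ y₂) ⟩
        κ r₁ s₁ xor κ r₂ s₂
          ∎

module Singular {n} (A : Matrix n) (A-sym : Symmetric A) (u : Bits n)
                (z : Bits n) (z∈ker : KernelOn A u z) (j : Fin n) (zj : z j ≡ true) where

  KernelIsLine : Set
  KernelIsLine = ∀ v → KernelOn A u v → IsZero v ⊎ v ≗ z

  KernelIsLine? : Dec KernelIsLine
  KernelIsLine? = all-Bits? (λ v → KernelOn A u v → IsZero v ⊎ v ≗ z)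
    (λ x≗y line y∈ker → Sum.map (λ x≡0 k → trans (sym (x≗y k)) (x≡0 k)) (λ x≗z k → trans (sym (x≗y k)) (x≗z k))
                                (line (KernelOn-resp A u (sym ∘ x≗y) y∈ker)))
    (λ v → KernelOn? A u v →-dec (IsZero? v ⊎-dec all? (λ k → v k ≟ᵇ z k)))

  κ : Bits n → Bool → Bool
  κ r s = does KernelIsLine? ∧ dot r z

  nonsingular⇒meets-kernel : ∀ {r s} → BorderedNonsingular A u r s → dot r z ≡ true
  nonsingular⇒meets-kernel {r} bordered with dot r z in rz
  ... | true  = refl
  ... | false = ⊥-elim (bit-conflict zj (proj₂ (bordered z false (proj₁ z∈ker , proj₂ z∈ker , rz)) j))

  nonsingular⇒line : ∀ {r s} → BorderedNonsingular A u r s → KernelIsLine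
  nonsingular⇒line {r} bordered v v∈ker with dot r v in rv
  ... | false = inj₁ (proj₂ (bordered v false (proj₁ v∈ker , proj₂ v∈ker , rv)))
  ... | true  = inj₂ (λ k → xor≡false⇒≡ (proj₂ (bordered (v ⊕ z) false (proj₁ v⊕z∈ker , proj₂ v⊕z∈ker , r·v⊕z≡0)) k))
    where
      v⊕z∈ker : KernelOn A u (v ⊕ z)
      v⊕z∈ker = KernelOn-⊕ A u v∈ker z∈ker
      r·v⊕z≡0 : dot r (v ⊕ z) ≡ false
      r·v⊕z≡0 = trans (dot-⊕ʳ r v z) (cong₂ _xor_ rv (nonsingular⇒meets-kernel bordered))

  line⇒nonsingular : ∀ {r s} → KernelIsLine → dot r z ≡ true → BorderedNonsingular A u r s
  line⇒nonsingular {r} line rz x true (x⊆u , Ax≡r , _) = ⊥-elim (bit-conflict rz (begin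
    dot r z          ≡⟨ dot-onSupport (λ k zk → xor≡false⇒≡ (Ax≡r k (proj₁ z∈ker k zk))) ⟩
    dot (A · x) z    ≡⟨ dot-·-sym A A-sym x z ⟩
    dot x (A · z)    ≡⟨ dot-vanishing x⊆u (proj₂ z∈ker) ⟩
    false            ∎))
    where open ≡-Reasoning
  line⇒nonsingular {r} line rz x false (x⊆u , Ax≡0 , rx≡0) with line x (x⊆u , Ax≡0)
  ... | inj₁ x≡0 = refl , x≡0
  ... | inj₂ x≗z = ⊥-elim (bit-conflict rz (trans (dot-cong {r = r} (λ _ → refl) (sym ∘ x≗z)) rx≡0))

  κ-reflects : ∀ r s → Reflects (BorderedNonsingular A u r s) (κ r s)
  κ-reflects r s = reflects
    (λ bordered → trans (cong (_∧ dot r z) (dec-true KernelIsLine? (nonsingular⇒line bordered))) (nonsingular⇒meets-kernel bordered))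
    complete
    where
      complete : κ r s ≡ true → BorderedNonsingular A u r s
      complete κ≡true with KernelIsLine?
      ... | yes line = line⇒nonsingular line κ≡true

  κ-linear : ∀ r₁ s₁ r₂ s₂ → κ (r₁ ⊕ r₂) (s₁ xor s₂) ≡ κ r₁ s₁ xor κ r₂ s₂
  κ-linear r₁ s₁ r₂ s₂ = trans (cong (does KernelIsLine? ∧_) (dot-⊕ˡ r₁ r₂ z)) (∧-distribˡ-xor (does KernelIsLine?) (dot r₁ z) (dot r₂ z))

-- The indicator is s + rᵀ A[u]⁻¹ r if A[u] is nonsingular (additive in r as A is symmetric), and
-- [ker A[u] is the line through z] ∧ r·z otherwise.
borderedNonsingular-linear : ∀ {n} (A : Matrix n) → Symmetric A → (u : Bits n) →
  ∃ λ (κ : Bits n → Bool → Bool) → (∀ r s → Reflects (BorderedNonsingular A u r s) (κ r s)) ×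
    (∀ r₁ s₁ r₂ s₂ → κ (r₁ ⊕ r₂) (s₁ xor s₂) ≡ κ r₁ s₁ xor κ r₂ s₂)
borderedNonsingular-linear A A-sym u with NonsingularOn? A u
... | yes nonsingular = let open Regular A A-sym u nonsingular in κ , κ-reflects , κ-linear
... | no singular with singular⇒kernelVector A u singular
... | z , z∈ker , j , zj = let open Singular A A-sym u z z∈ker j zj in κ , κ-reflects , κ-linear

_∖_ : ∀ {n} → Bits n → Fin n → Bits n
(w ∖ a) k = w k ∧ not (δ k a)

∖-⊆ᵇ : ∀ {n} (w : Bits n) a → (w ∖ a) ⊆ᵇ w
∖-⊆ᵇ w a k w∖a with w k
... | true  = refl
... | false = w∖a

∖-self : ∀ {n} (w : Bits n) a → (w ∖ a) a ≡ false
∖-self w a rewrite δ-refl a = ∧-zeroʳ (w a)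

∖-≢ : ∀ {n} (w : Bits n) {a k} → k ≢ a → (w ∖ a) k ≡ w k
∖-≢ w {a} {k} k≢a rewrite δ-≢ k≢a = ∧-identityʳ (w k)

∈∖⇒≢ : ∀ {n} (w : Bits n) {a k} → (w ∖ a) k ≡ true → k ≢ a
∈∖⇒≢ w {a} w∖a refl = bit-conflict w∖a (∖-self w a)

[_↦_] : ∀ {n} → Fin n → Bool → Bits n
[ a ↦ t ] k = t ∧ δ k a

·-[↦] : ∀ {n} (A : Matrix n) a t i → (A · [ a ↦ t ]) i ≡ t ∧ A i a
·-[↦] A a t i = trans (Σ₂-cong (λ k → truth-table 3 (λ p q d → p ∧ (q ∧ d)) (λ p q d → d ∧ (q ∧ p)) _ (A i k) t (δ k a)))
                      (Σ₂-δ a (λ k → t ∧ A i k))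

split-at : ∀ {n} (x : Bits n) a → x ≗ [ a ↦ x a ] ⊕ (x ∖ a)
split-at x a k with k ≟ a
... | yes refl = truth-table 1 (λ p → p) (λ p → (p ∧ true) xor (p ∧ false)) _ (x k)
... | no k≢a   = truth-table 2 (λ p q → p) (λ p q → (q ∧ false) xor (p ∧ true)) _ (x k) (x a)

·-split : ∀ {n} (A : Matrix n) x a i → (A · x) i ≡ (x a ∧ A i a) xor (A · (x ∖ a)) i
·-split A x a i = trans (·-cong A (split-at x a) i) (trans (·-⊕ A _ _ i) (cong (_xor (A · (x ∖ a)) i) (·-[↦] A a (x a) i)))

column : ∀ {n} → Matrix n → Fin n → Bits n
column A a k = A k a

dot-column : ∀ {n} (A : Matrix n) → Symmetric A → ∀ a x → dot (column A a) x ≡ (A · x) a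
dot-column A A-sym a x = Σ₂-cong (λ k → cong (_∧ x k) (A-sym k a))

[↦]-⊆ᵇ : ∀ {n} {w : Bits n} {a} t → w a ≡ true → [ a ↦ t ] ⊆ᵇ w
[↦]-⊆ᵇ {w = w} {a} t wa k t∧δ with k ≟ a
... | yes refl = wa
... | no _     = ⊥-elim (bit-conflict t∧δ (∧-zeroʳ t))

module _ {n} (A : Matrix n) (A-sym : Symmetric A) (w : Bits n) (a : Fin n) (wa : w a ≡ true) where

  nonsingular⇒bordered : NonsingularOn A w → BorderedNonsingular A (w ∖ a) (column A a) (A a a)
  nonsingular⇒bordered nonsingular x t (x⊆w∖a , border , corner) = t≡false , λ k → subst (λ t → x′ t k ≡ false) t≡false (x′≡0 k)
    where
      x′ : Bool → Bits n
      x′ t = [ a ↦ t ] ⊕ x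
      xa : x a ≡ false
      xa = ≢true⇒≡false (λ xa → bit-conflict (x⊆w∖a a xa) (∖-self w a))
      Ax′≡0 : ∀ i → w i ≡ true → (A · x′ t) i ≡ false
      Ax′≡0 i wi with i ≟ a
      ... | yes refl = trans (·-⊕ A _ x i) (trans (cong₂ _xor_ (·-[↦] A i t i) (sym (dot-column A A-sym i x))) corner)
      ... | no i≢a   = trans (·-⊕ A _ x i) (trans (cong (_xor (A · x) i) (·-[↦] A a t i)) (border i (trans (∖-≢ w i≢a) wi)))
      x′≡0 : IsZero (x′ t)
      x′≡0 = nonsingular (x′ t) (⊕-⊆ᵇ {x = [ a ↦ t ]} ([↦]-⊆ᵇ t wa) (λ k xk → ∖-⊆ᵇ w a k (x⊆w∖a k xk)) , Ax′≡0)
      t≡false : t ≡ false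
      t≡false = trans (sym (truth-table 1 (λ t → (t ∧ true) xor false) (λ t → t) _ t))
                      (trans (cong₂ (λ d x → (t ∧ d) xor x) (sym (δ-refl a)) (sym xa)) (x′≡0 a))

  bordered⇒nonsingular : BorderedNonsingular A (w ∖ a) (column A a) (A a a) → NonsingularOn A w
  bordered⇒nonsingular bordered x (x⊆w , Ax≡0) k = trans (split-at x a k) (cong₂ _xor_ (cong (_∧ δ k a) xa≡0) (x∖a≡0 k))
    where
      x∖a⊆w∖a : (x ∖ a) ⊆ᵇ (w ∖ a)
      x∖a⊆w∖a k x∖a with x k in xk
      ... | true  = trans (cong (_∧ not (δ k a)) (x⊆w k xk)) x∖a
      ... | false = ⊥-elim (bit-conflict x∖a refl)
      result : x a ≡ false × IsZero (x ∖ a)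
      result = bordered (x ∖ a) (x a) (x∖a⊆w∖a ,
                 (λ i ui → trans (sym (·-split A x a i)) (Ax≡0 i (∖-⊆ᵇ w a i ui))) ,
                 trans (cong ((x a ∧ A a a) xor_) (dot-column A A-sym a (x ∖ a))) (trans (sym (·-split A x a a)) (Ax≡0 a wa)))
      xa≡0 : x a ≡ false
      xa≡0 = proj₁ result
      x∖a≡0 : IsZero (x ∖ a)
      x∖a≡0 = proj₂ result

  nonsingular⇔bordered : NonsingularOn A w ⇔ BorderedNonsingular A (w ∖ a) (column A a) (A a a)
  nonsingular⇔bordered = mk⇔ nonsingular⇒bordered bordered⇒nonsingular

basis : ∀ {n} → Fin n → Bits n
basis b k = δ k b

basis-true : ∀ {n} {k i : Fin n} → basis i k ≡ true → k ≡ i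
basis-true {k = k} {i} δ≡true with k ≟ i
... | yes k≡i = k≡i

bordered-basis⇔nonsingular : ∀ {n} (A : Matrix n) u b → u b ≡ true →
  BorderedNonsingular A u (basis b) false ⇔ NonsingularOn A (u ∖ b)
bordered-basis⇔nonsingular {n} A u b ub = mk⇔ sound complete
  where
    sound : BorderedNonsingular A u (basis b) false → NonsingularOn A (u ∖ b)
    sound bordered x (x⊆u∖b , Ax≡0) = proj₂ (bordered x ((A · x) b) (x⊆u , border , corner))
      where
        x⊆u : x ⊆ᵇ u
        x⊆u k xk = ∖-⊆ᵇ u b k (x⊆u∖b k xk)
        border : ∀ i → u i ≡ true → ((A · x) b ∧ δ i b) xor (A · x) i ≡ false
        border i ui with i ≟ b
        ... | yes refl = trans (cong (_xor (A · x) i) (∧-identityʳ ((A · x) i))) (xor-same ((A · x) i))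
        ... | no i≢b   = trans (cong (_xor (A · x) i) (∧-zeroʳ ((A · x) b))) (Ax≡0 i (trans (∖-≢ u i≢b) ui))
        corner : ((A · x) b ∧ false) xor dot (basis b) x ≡ false
        corner = trans (cong₂ _xor_ (∧-zeroʳ ((A · x) b)) (Σ₂-δ b x)) (≢true⇒≡false (λ xb → bit-conflict (x⊆u∖b b xb) (∖-self u b)))
    complete : NonsingularOn A (u ∖ b) → BorderedNonsingular A u (basis b) false
    complete nonsingular x t (x⊆u , border , corner) = t≡false , x≡0
      where
        xb : x b ≡ false
        xb = trans (sym (Σ₂-δ b x)) (trans (cong (_xor dot (basis b) x) (sym (∧-zeroʳ t))) corner)
        x⊆u∖b : x ⊆ᵇ (u ∖ b)
        x⊆u∖b k xk with k ≟ b
        ... | yes refl = ⊥-elim (bit-conflict xk xb)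
        ... | no _     = trans (∧-identityʳ (u k)) (x⊆u k xk)
        x≡0 : IsZero x
        x≡0 = nonsingular x (x⊆u∖b , λ i ui →
                trans (sym (cong (_xor (A · x) i) (trans (cong (t ∧_) (δ-≢ (∈∖⇒≢ u ui))) (∧-zeroʳ t)))) (border i (∖-⊆ᵇ u b i ui)))
        t≡false : t ≡ false
        t≡false = trans (sym (trans (cong₂ _xor_ (trans (cong (t ∧_) (δ-refl b)) (∧-identityʳ t)) (Σ₂-zero _ (λ k → trans (cong (A b k ∧_) (x≡0 k)) (∧-zeroʳ _))))
                                    (xor-identityʳ t)))
                        (border b ub)

-- Elementary congruences

-- E A Eᵀ with E = I + e_a e_bᵀ: row and column b are added to row and column a.
addRowCol : ∀ {n} → Fin n → Fin n → Matrix n → Matrix n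
addRowCol a b A i j = ((A i j xor (δ i a ∧ A b j)) xor (δ j a ∧ A i b)) xor (δ i a ∧ (δ j a ∧ A b b))

toggle : ∀ {n} → Fin n → Fin n → Matrix n → Matrix n
toggle a b A i j = (A i j xor (δ i a ∧ δ j b)) xor (δ i b ∧ δ j a)

addRowCol-sym : ∀ {n} a b (A : Matrix n) → Symmetric A → Symmetric (addRowCol a b A)
addRowCol-sym a b A A-sym i j rewrite A-sym i j | A-sym b j | A-sym i b =
  truth-table 6 (λ p di dj q r s → ((p xor (di ∧ q)) xor (dj ∧ r)) xor (di ∧ (dj ∧ s)))
                (λ p di dj q r s → ((p xor (dj ∧ r)) xor (di ∧ q)) xor (dj ∧ (di ∧ s))) _
                (A j i) (δ i a) (δ j a) (A j b) (A b i) (A b b)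

toggle-sym : ∀ {n} a b (A : Matrix n) → Symmetric A → Symmetric (toggle a b A)
toggle-sym a b A A-sym i j rewrite A-sym i j =
  truth-table 5 (λ p q r s t → (p xor (q ∧ r)) xor (s ∧ t)) (λ p q r s t → (p xor (t ∧ s)) xor (r ∧ q)) _
                (A j i) (δ i a) (δ j b) (δ i b) (δ j a)

addRowCol-outside : ∀ {n} a b (A : Matrix n) {i j} → i ≢ a → j ≢ a → addRowCol a b A i j ≡ A i j
addRowCol-outside a b A {i} {j} i≢a j≢a rewrite δ-≢ i≢a | δ-≢ j≢a =
  truth-table 1 (λ p → ((p xor false) xor false) xor false) (λ p → p) _ (A i j)

addRowCol-column : ∀ {n} a b (A : Matrix n) {k} → k ≢ a → addRowCol a b A k a ≡ A k a xor A k b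
addRowCol-column a b A {k} k≢a rewrite δ-≢ k≢a | δ-refl a =
  truth-table 2 (λ p r → ((p xor false) xor r) xor false) (λ p r → p xor r) _ (A k a) (A k b)

addRowCol-row : ∀ {n} a b (A : Matrix n) {k} → k ≢ a → addRowCol a b A a k ≡ A a k xor A b k
addRowCol-row a b A {k} k≢a rewrite δ-≢ k≢a | δ-refl a =
  truth-table 2 (λ p q → ((p xor q) xor false) xor false) (λ p q → p xor q) _ (A a k) (A b k)

addRowCol-corner : ∀ {n} a b (A : Matrix n) → addRowCol a b A a a ≡ ((A a a xor A b a) xor A a b) xor A b b
addRowCol-corner a b A rewrite δ-refl a = refl

addRowCol-corner-sym : ∀ {n} a b (A : Matrix n) → Symmetric A → addRowCol a b A a a ≡ A a a xor A b b
addRowCol-corner-sym a b A A-sym rewrite addRowCol-corner a b A | A-sym b a =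
  truth-table 3 (λ p q r → ((p xor q) xor q) xor r) (λ p q r → p xor r) _ (A a a) (A a b) (A b b)

toggle-outsideᵃ : ∀ {n} a b (A : Matrix n) {i j} → i ≢ a → j ≢ a → toggle a b A i j ≡ A i j
toggle-outsideᵃ a b A {i} {j} i≢a j≢a rewrite δ-≢ i≢a | δ-≢ j≢a =
  truth-table 2 (λ p q → (p xor false) xor (q ∧ false)) (λ p _ → p) _ (A i j) (δ i b)

toggle-outsideᵇ : ∀ {n} a b (A : Matrix n) {i j} → i ≢ b → j ≢ b → toggle a b A i j ≡ A i j
toggle-outsideᵇ a b A {i} {j} i≢b j≢b rewrite δ-≢ i≢b | δ-≢ j≢b =
  truth-table 2 (λ p q → (p xor (q ∧ false)) xor false) (λ p _ → p) _ (A i j) (δ i a)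

toggle-row : ∀ {n} a b (A : Matrix n) {i} j → i ≢ a → i ≢ b → toggle a b A i j ≡ A i j
toggle-row a b A {i} j i≢a i≢b rewrite δ-≢ i≢a | δ-≢ i≢b =
  truth-table 1 (λ p → (p xor false) xor false) (λ p → p) _ (A i j)

toggle-column : ∀ {n} a b (A : Matrix n) {k} → k ≢ a → toggle a b A k a ≡ A k a xor δ k b
toggle-column a b A {k} k≢a rewrite δ-≢ k≢a | δ-refl a =
  truth-table 2 (λ p r → (p xor false) xor (r ∧ true)) (λ p r → p xor r) _ (A k a) (δ k b)

toggle-corner : ∀ {n} a b (A : Matrix n) → a ≢ b → toggle a b A a a ≡ A a a
toggle-corner a b A a≢b rewrite δ-refl a | δ-≢ a≢b =
  truth-table 1 (λ p → (p xor false) xor false) (λ p → p) _ (A a a)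

toggle-pair : ∀ {n} a b (A : Matrix n) → a ≢ b → toggle a b A a b ≡ not (A a b)
toggle-pair a b A a≢b rewrite δ-refl a | δ-refl b | δ-≢ a≢b =
  truth-table 1 (λ p → (p xor true) xor false) not _ (A a b)

toggle-rowᵃ : ∀ {n} a b (A : Matrix n) {j} → a ≢ b → j ≢ b → toggle a b A a j ≡ A a j
toggle-rowᵃ a b A {j} a≢b j≢b rewrite δ-refl a | δ-≢ a≢b | δ-≢ j≢b =
  truth-table 1 (λ p → (p xor false) xor false) (λ p → p) _ (A a j)

toggle-comm : ∀ {n} a b (A : Matrix n) i j → toggle b a A i j ≡ toggle a b A i j
toggle-comm a b A i j =
  truth-table 5 (λ p q r s t → (p xor (q ∧ r)) xor (s ∧ t)) (λ p q r s t → (p xor (s ∧ t)) xor (q ∧ r)) _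
                (A i j) (δ i b) (δ j a) (δ i a) (δ j b)

addRowCol-row-unchanged : ∀ {n} c d (A : Matrix n) {m} j → m ≢ c → A m d ≡ false → addRowCol c d A m j ≡ A m j
addRowCol-row-unchanged c d A {m} j m≢c Amd = byCase (j ≟ c)
  where
    byCase : Dec (j ≡ c) → addRowCol c d A m j ≡ A m j
    byCase (yes refl) = trans (addRowCol-column c d A m≢c) (trans (cong (A m j xor_) Amd) (xor-identityʳ (A m j)))
    byCase (no j≢c)   = addRowCol-outside c d A m≢c j≢c

addRowCol-involutive : ∀ {n} a b (A : Matrix n) → a ≢ b → ∀ i j → addRowCol a b (addRowCol a b A) i j ≡ A i j
addRowCol-involutive {n} a b A a≢b i j = cases (i ≟ a) (j ≟ a)
  where
  cases : Dec (i ≡ a) → Dec (j ≡ a) → addRowCol a b (addRowCol a b A) i j ≡ A i j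
  cases (no i≢a) (no j≢a) = trans (addRowCol-outside a b (addRowCol a b A) i≢a j≢a) (addRowCol-outside a b A i≢a j≢a)
  cases (no i≢a) (yes refl) =
    trans (addRowCol-column a b (addRowCol a b A) i≢a) (trans (cong₂ _xor_ (addRowCol-column a b A i≢a) (addRowCol-outside a b A i≢a (a≢b ∘ sym)))
          (truth-table 2 (λ p q → (p xor q) xor q) (λ p q → p) _ (A i j) (A i b)))
  cases (yes refl) (no j≢a) =
    trans (addRowCol-row a b (addRowCol a b A) j≢a) (trans (cong₂ _xor_ (addRowCol-row a b A j≢a) (addRowCol-outside a b A (a≢b ∘ sym) j≢a))
          (truth-table 2 (λ p q → (p xor q) xor q) (λ p q → p) _ (A i j) (A b j)))
  cases (yes refl) (yes refl) = begin
    addRowCol i b A′ i i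
      ≡⟨ addRowCol-corner i b A′ ⟩
    ((A′ i i xor A′ b i) xor A′ i b) xor A′ b b
      ≡⟨ cong₂ (λ p q → ((p xor q) xor A′ i b) xor A′ b b) (addRowCol-corner i b A) (addRowCol-column i b A b≢i) ⟩
    ((X xor (A b i xor A b b)) xor A′ i b) xor A′ b b
      ≡⟨ cong₂ (λ p q → ((X xor (A b i xor A b b)) xor p) xor q) (addRowCol-row i b A b≢i) (addRowCol-outside i b A b≢i b≢i) ⟩
    ((X xor (A b i xor A b b)) xor (A i b xor A b b)) xor A b b
      ≡⟨ truth-table 4 (λ p q r s → ((((((p xor q) xor r) xor s) xor (q xor s)) xor (r xor s)) xor s)) (λ p _ _ _ → p) _
                       (A i i) (A b i) (A i b) (A b b) ⟩
    A i i
      ∎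
    where
      open ≡-Reasoning
      b≢i : b ≢ i
      b≢i = a≢b ∘ sym
      A′ : Matrix n
      A′ = addRowCol i b A
      X : Bool
      X = ((A i i xor A b i) xor A i b) xor A b b

·-addRowCol : ∀ {n} a b (A : Matrix n) x i →
  (addRowCol a b A · x) i ≡ (A · (x ⊕ [ b ↦ x a ])) i xor (δ i a ∧ (A · (x ⊕ [ b ↦ x a ])) b)
·-addRowCol {n} a b A x i = begin
  Σ₂ (λ k → addRowCol a b A i k ∧ x k)
    ≡⟨ Σ₂-cong (λ k → truth-table 7 (λ p di q dk r s xk → (((p xor (di ∧ q)) xor (dk ∧ r)) xor (di ∧ (dk ∧ s))) ∧ xk)
                                     (λ p di q dk r s xk → ((p ∧ xk) xor (r ∧ (dk ∧ xk))) xor (di ∧ ((q ∧ xk) xor (s ∧ (dk ∧ xk))))) _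
                                     (A i k) (δ i a) (A b k) (δ k a) (A i b) (A b b) (x k)) ⟩
  Σ₂ (λ k → ((A i k ∧ x k) xor (A i b ∧ (δ k a ∧ x k))) xor (δ i a ∧ ((A b k ∧ x k) xor (A b b ∧ (δ k a ∧ x k)))))
    ≡⟨ Σ₂-xor (λ k → (A i k ∧ x k) xor (A i b ∧ (δ k a ∧ x k))) (λ k → δ i a ∧ ((A b k ∧ x k) xor (A b b ∧ (δ k a ∧ x k)))) ⟩
  Σ₂ (λ k → (A i k ∧ x k) xor (A i b ∧ (δ k a ∧ x k))) xor Σ₂ (λ k → δ i a ∧ ((A b k ∧ x k) xor (A b b ∧ (δ k a ∧ x k))))
    ≡⟨ cong₂ _xor_ (row i) (trans (Σ₂-∧ˡ (δ i a) (λ k → (A b k ∧ x k) xor (A b b ∧ (δ k a ∧ x k)))) (cong (δ i a ∧_) (row b))) ⟩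
  (A · y) i xor (δ i a ∧ (A · y) b)
    ∎
  where
    open ≡-Reasoning
    y : Bits n
    y = x ⊕ [ b ↦ x a ]
    row : ∀ j → Σ₂ (λ k → (A j k ∧ x k) xor (A j b ∧ (δ k a ∧ x k))) ≡ (A · y) j
    row j = begin
      Σ₂ (λ k → (A j k ∧ x k) xor (A j b ∧ (δ k a ∧ x k)))
        ≡⟨ Σ₂-xor (λ k → A j k ∧ x k) (λ k → A j b ∧ (δ k a ∧ x k)) ⟩
      (A · x) j xor Σ₂ (λ k → A j b ∧ (δ k a ∧ x k))
        ≡⟨ cong ((A · x) j xor_) (trans (Σ₂-∧ˡ (A j b) (λ k → δ k a ∧ x k)) (trans (cong (A j b ∧_) (Σ₂-δ a x)) (∧-comm (A j b) (x a)))) ⟩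
      (A · x) j xor (x a ∧ A j b)
        ≡⟨ sym (trans (·-⊕ A x [ b ↦ x a ] j) (cong ((A · x) j xor_) (·-[↦] A b (x a) j))) ⟩
      (A · y) j
        ∎

addRowCol-preserves-nonsingular : ∀ {n} a b (A : Matrix n) (w : Bits n) → a ≢ b → w a ≡ true → w b ≡ true →
  NonsingularOn A w → NonsingularOn (addRowCol a b A) w
addRowCol-preserves-nonsingular {n} a b A w a≢b wa wb nonsingular x (x⊆w , A′x≡0) k =
  trans (sym (trans (cong (λ xa → x k xor (xa ∧ δ k b)) xa≡0) (xor-identityʳ (x k)))) (y≡0 k)
  where
    y : Bits n
    y = x ⊕ [ b ↦ x a ]
    Ay-at : ∀ i → (addRowCol a b A · x) i ≡ (A · y) i xor (δ i a ∧ (A · y) b)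
    Ay-at = ·-addRowCol a b A x
    Ayb≡0 : (A · y) b ≡ false
    Ayb≡0 = trans (sym (trans (Ay-at b) (trans (cong (λ d → (A · y) b xor (d ∧ (A · y) b)) (δ-≢ (a≢b ∘ sym))) (xor-identityʳ _))))
                  (A′x≡0 b wb)
    Ay≡0 : ∀ i → w i ≡ true → (A · y) i ≡ false
    Ay≡0 i wi = trans (sym (trans (Ay-at i) (trans (cong (λ c → (A · y) i xor (δ i a ∧ c)) Ayb≡0)
                                        (trans (cong ((A · y) i xor_) (∧-zeroʳ _)) (xor-identityʳ _)))))
                      (A′x≡0 i wi)
    y≡0 : IsZero y
    y≡0 = nonsingular y (⊕-⊆ᵇ {x = x} x⊆w ([↦]-⊆ᵇ (x a) wb) , Ay≡0)
    xa≡0 : x a ≡ false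
    xa≡0 = trans (sym (trans (cong (λ d → x a xor (x a ∧ d)) (δ-≢ a≢b)) (trans (cong (x a xor_) (∧-zeroʳ _)) (xor-identityʳ _)))) (y≡0 a)

NonsingularOn-⇔ : ∀ {n} {A B : Matrix n} {w v : Bits n} → w ≗ v →
  (∀ i j → w i ≡ true → w j ≡ true → A i j ≡ B i j) → NonsingularOn A w ⇔ NonsingularOn B v
NonsingularOn-⇔ w≗v A≡B = mk⇔ (NonsingularOn-cong w≗v A≡B)
  (NonsingularOn-cong (sym ∘ w≗v) (λ i j vi vj → sym (A≡B i j (trans (w≗v i) vi) (trans (w≗v j) vj))))

BorderedNonsingular-⇔ : ∀ {n} {A A′ : Matrix n} {u u′ r r′ : Bits n} {s s′ : Bool} → u ≗ u′ →
  (∀ i j → u i ≡ true → u j ≡ true → A i j ≡ A′ i j) → (∀ i → u i ≡ true → r i ≡ r′ i) → s ≡ s′ →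
  BorderedNonsingular A u r s ⇔ BorderedNonsingular A′ u′ r′ s′
BorderedNonsingular-⇔ {u = u} {u′} u≗u′ A≡A′ r≡r′ s≡s′ = mk⇔ (BorderedNonsingular-cong u≗u′ A≡A′ r≡r′ s≡s′)
  (BorderedNonsingular-cong (sym ∘ u≗u′) (λ i j u′i u′j → sym (A≡A′ i j (on u′i) (on u′j))) (λ i u′i → sym (r≡r′ i (on u′i))) (sym s≡s′))
  where
    on : ∀ {i} → u′ i ≡ true → u i ≡ true
    on {i} = trans (u≗u′ i)

≢-by-membership : ∀ {n} (w : Bits n) {i a} → w i ≡ true → w a ≡ false → i ≢ a
≢-by-membership w wi wa refl = bit-conflict wi wa

addRowCol-away : ∀ {n} a b (A : Matrix n) (w : Bits n) → w a ≡ false → NonsingularOn (addRowCol a b A) w ⇔ NonsingularOn A w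
addRowCol-away a b A w wa =
  NonsingularOn-⇔ (λ _ → refl) (λ i j wi wj → addRowCol-outside a b A (≢-by-membership w wi wa) (≢-by-membership w wj wa))

addRowCol-inside : ∀ {n} a b (A : Matrix n) (w : Bits n) → a ≢ b → w a ≡ true → w b ≡ true →
  NonsingularOn (addRowCol a b A) w ⇔ NonsingularOn A w
addRowCol-inside a b A w a≢b wa wb = mk⇔
  (λ nonsingular → NonsingularOn-cong (λ _ → refl) (λ i j _ _ → addRowCol-involutive a b A a≢b i j)
                     (addRowCol-preserves-nonsingular a b (addRowCol a b A) w a≢b wa wb nonsingular))
  (addRowCol-preserves-nonsingular a b A w a≢b wa wb)

toggle-away : ∀ {n} a b (A : Matrix n) (w : Bits n) → w a ≡ false ⊎ w b ≡ false →
  NonsingularOn (toggle a b A) w ⇔ NonsingularOn A w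
toggle-away a b A w (inj₁ wa) =
  NonsingularOn-⇔ (λ _ → refl) (λ i j wi wj → toggle-outsideᵃ a b A (≢-by-membership w wi wa) (≢-by-membership w wj wa))
toggle-away a b A w (inj₂ wb) =
  NonsingularOn-⇔ (λ _ → refl) (λ i j wi wj → toggle-outsideᵇ a b A (≢-by-membership w wi wb) (≢-by-membership w wj wb))

-- All three matrices are bordered extensions of A[w ∖ a]; their borders are column a, column b
-- and the sum of the two, so the linearity of bordered nonsingularity gives the xor.
addRowCol-xor : ∀ {n} a b (A : Matrix n) → Symmetric A → a ≢ b → (w w′ : Bits n) → w a ≡ true → w′ b ≡ true →
  w′ ∖ b ≗ w ∖ a →
  XorReflected (NonsingularOn A w) (NonsingularOn A w′) (NonsingularOn (addRowCol a b A) w)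
addRowCol-xor {n} a b A A-sym a≢b w w′ wa w′b w′∖b≗w∖a with borderedNonsingular-linear A A-sym (w ∖ a)
... | κ , κ-reflects , κ-linear =
  κ (column A a) (A a a) , κ (column A b) (A b b) ,
  Reflects-⇔ (nonsingular⇔bordered A A-sym w a wa) (κ-reflects (column A a) (A a a)) ,
  Reflects-⇔ (⇔.trans (nonsingular⇔bordered A A-sym w′ b w′b) (BorderedNonsingular-⇔ w′∖b≗w∖a (λ _ _ _ _ → refl) (λ _ _ → refl) refl)) (κ-reflects (column A b) (A b b)) ,
  Reflects-⇔ (⇔.trans (nonsingular⇔bordered A′ (addRowCol-sym a b A A-sym) w a wa)
                      (BorderedNonsingular-⇔ (λ _ → refl) (λ i j ui uj → addRowCol-outside a b A (∈∖⇒≢ w ui) (∈∖⇒≢ w uj))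
                                             (λ i ui → addRowCol-column a b A (∈∖⇒≢ w ui)) (addRowCol-corner-sym a b A A-sym)))
             (subst (Reflects _) (κ-linear (column A a) (A a a) (column A b) (A b b)) (κ-reflects (column A a ⊕ column A b) (A a a xor A b b)))
  where
    A′ : Matrix n
    A′ = addRowCol a b A

-- As above, now with borders column a, e_b and their sum; the second matrix is A[w ∖ {a, b}].
toggle-xor : ∀ {n} a b (A : Matrix n) → Symmetric A → a ≢ b → (w w′ : Bits n) → w a ≡ true → w b ≡ true →
  w′ ≗ (w ∖ a) ∖ b →
  XorReflected (NonsingularOn A w) (NonsingularOn A w′) (NonsingularOn (toggle a b A) w)
toggle-xor {n} a b A A-sym a≢b w w′ wa wb w′≗ with borderedNonsingular-linear A A-sym (w ∖ a)
... | κ , κ-reflects , κ-linear =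
  κ (column A a) (A a a) , κ (basis b) false ,
  Reflects-⇔ (nonsingular⇔bordered A A-sym w a wa) (κ-reflects (column A a) (A a a)) ,
  Reflects-⇔ (⇔.trans (NonsingularOn-⇔ w′≗ (λ _ _ _ _ → refl)) (⇔.sym (bordered-basis⇔nonsingular A (w ∖ a) b u-b)))
             (κ-reflects (basis b) false) ,
  Reflects-⇔ (⇔.trans (nonsingular⇔bordered A′ (toggle-sym a b A A-sym) w a wa)
                      (BorderedNonsingular-⇔ (λ _ → refl) (λ i j ui uj → toggle-outsideᵃ a b A (∈∖⇒≢ w ui) (∈∖⇒≢ w uj))
                                             (λ i ui → toggle-column a b A (∈∖⇒≢ w ui))
                                             (trans (toggle-corner a b A a≢b) (sym (xor-identityʳ (A a a))))))
             (subst (Reflects _) (κ-linear (column A a) (A a a) (basis b) false) (κ-reflects (column A a ⊕ basis b) (A a a xor false)))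
  where
    A′ : Matrix n
    A′ = toggle a b A
    u-b : (w ∖ a) b ≡ true
    u-b = trans (∖-≢ w (a≢b ∘ sym)) wb

-- Handle slides as matrix operations

Subset-ext : ∀ {n} {p q : Subset n} → lookup p ≗ lookup q → p ≡ q
Subset-ext {p = p} {q} p≗q = trans (sym (tabulate∘lookup p)) (trans (tabulate-cong p≗q) (tabulate∘lookup q))

lookup-Δ : ∀ {n} (p q : Subset n) i → lookup (p Δ q) i ≡ lookup p i xor lookup q i
lookup-Δ p q i = lookup-zipWith _xor_ i p q

lookup-∪ : ∀ {n} (p q : Subset n) i → lookup (p ∪ q) i ≡ lookup p i ∨ lookup q i
lookup-∪ p q i = lookup-zipWith _∨_ i p q

lookup-∁ : ∀ {n} (p : Subset n) i → lookup (∁ p) i ≡ not (lookup p i)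
lookup-∁ p i = lookup-map i not p

lookup-⁅⁆ : ∀ {n} (a i : Fin n) → lookup ⁅ a ⁆ i ≡ δ i a
lookup-⁅⁆ zero    zero    = refl
lookup-⁅⁆ zero    (suc i) = lookup-replicate i false
lookup-⁅⁆ (suc a) zero    = refl
lookup-⁅⁆ (suc a) (suc i) with i ≟ a | lookup-⁅⁆ a i
... | yes refl | eq = eq
... | no _     | eq = eq

lookup-pair : ∀ {n} (a b k : Fin n) → lookup (⁅ a ⁆ ∪ ⁅ b ⁆) k ≡ δ k a ∨ δ k b
lookup-pair a b k = trans (lookup-∪ ⁅ a ⁆ ⁅ b ⁆ k) (cong₂ _∨_ (lookup-⁅⁆ a k) (lookup-⁅⁆ b k))

lookup-Δpair : ∀ {n} (Y : Subset n) a b k → lookup (Y Δ (⁅ a ⁆ ∪ ⁅ b ⁆)) k ≡ lookup Y k xor (δ k a ∨ δ k b)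
lookup-Δpair Y a b k = trans (lookup-Δ Y _ k) (cong (lookup Y k xor_) (lookup-pair a b k))

∈∁pair⇒off : ∀ {n} {a b k : Fin n} {X : Subset n} → X ⊆ ∁ (⁅ a ⁆ ∪ ⁅ b ⁆) → lookup X k ≡ true → δ k a ∨ δ k b ≡ false
∈∁pair⇒off {a = a} {b} {k} X⊆ Xk =
  not-injective (trans (sym (cong not (lookup-pair a b k))) (trans (sym (lookup-∁ (⁅ a ⁆ ∪ ⁅ b ⁆) k)) (lookup-∈ (X⊆ (∈-lookup Xk)))))

module _ {n} (a b : Fin n) (a≢b : a ≢ b) (𝓖 : Family n) (Y : Subset n) where

  slideSet⇒ : slideSet a b 𝓖 Y → lookup Y a ≡ true × lookup Y b ≡ false × 𝓖 (Y Δ (⁅ a ⁆ ∪ ⁅ b ⁆))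
  slideSet⇒ (X , X⊆ , 𝓖X∪b , refl) = Ya , Yb , subst 𝓖 (Subset-ext pointwise) 𝓖X∪b
    where
      X-off : ∀ k → (k ≡ a ⊎ k ≡ b) → lookup X k ≡ false
      X-off k k∈ab = ≢true⇒≡false (λ Xk → bit-conflict (on k∈ab) (∈∁pair⇒off X⊆ Xk))
        where
          on : (k ≡ a ⊎ k ≡ b) → δ k a ∨ δ k b ≡ true
          on (inj₁ refl) rewrite δ-refl k = refl
          on (inj₂ refl) rewrite δ-refl k = ∨-zeroʳ _
      Ya : lookup (X ∪ ⁅ a ⁆) a ≡ true
      Ya = trans (lookup-∪ X ⁅ a ⁆ a) (trans (cong (lookup X a ∨_) (trans (lookup-⁅⁆ a a) (δ-refl a))) (∨-zeroʳ _))
      Yb : lookup (X ∪ ⁅ a ⁆) b ≡ false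
      Yb = trans (lookup-∪ X ⁅ a ⁆ b) (cong₂ _∨_ (X-off b (inj₂ refl)) (trans (lookup-⁅⁆ a b) (δ-≢ (a≢b ∘ sym))))
      pointwise : ∀ k → lookup (X ∪ ⁅ b ⁆) k ≡ lookup ((X ∪ ⁅ a ⁆) Δ (⁅ a ⁆ ∪ ⁅ b ⁆)) k
      pointwise k rewrite lookup-Δpair (X ∪ ⁅ a ⁆) a b k | lookup-∪ X ⁅ a ⁆ k | lookup-∪ X ⁅ b ⁆ k | lookup-⁅⁆ a k | lookup-⁅⁆ b k
        with k ≟ a | k ≟ b
      ... | yes refl | yes refl = ⊥-elim (a≢b refl)
      ... | yes refl | no _     rewrite X-off k (inj₁ refl) = refl
      ... | no _     | yes refl rewrite X-off k (inj₂ refl) = refl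
      ... | no _     | no _     = sym (xor-identityʳ _)
  ⇒slideSet : lookup Y a ≡ true × lookup Y b ≡ false × 𝓖 (Y Δ (⁅ a ⁆ ∪ ⁅ b ⁆)) → slideSet a b 𝓖 Y
  ⇒slideSet (Ya , Yb , 𝓖YΔab) = X , X⊆ , subst 𝓖 (Subset-ext pointwise₁) 𝓖YΔab , Subset-ext pointwise₂
    where
      X : Subset n
      X = tabulate (λ k → lookup Y k ∧ not (δ k a))
      lookup-X : ∀ k → lookup X k ≡ lookup Y k ∧ not (δ k a)
      lookup-X = lookup∘tabulate (λ k → lookup Y k ∧ not (δ k a))
      X⊆ : X ⊆ ∁ (⁅ a ⁆ ∪ ⁅ b ⁆)
      X⊆ {k} k∈X = ∈-lookup (trans (lookup-∁ (⁅ a ⁆ ∪ ⁅ b ⁆) k) (cong not (trans (lookup-pair a b k) (off (k ≟ a) (k ≟ b)))))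
        where
          Xk : lookup Y k ∧ not (δ k a) ≡ true
          Xk = trans (sym (lookup-X k)) (lookup-∈ k∈X)
          off : Dec (k ≡ a) → Dec (k ≡ b) → δ k a ∨ δ k b ≡ false
          off (yes refl) _        = ⊥-elim (bit-conflict Xk (trans (cong (λ d → lookup Y k ∧ not d) (δ-refl k)) (∧-zeroʳ _)))
          off (no _)     (yes refl) = ⊥-elim (bit-conflict Xk (cong (_∧ not (δ k a)) Yb))
          off (no k≢a)   (no k≢b)   = cong₂ _∨_ (δ-≢ k≢a) (δ-≢ k≢b)
      pointwise₁ : ∀ k → lookup (Y Δ (⁅ a ⁆ ∪ ⁅ b ⁆)) k ≡ lookup (X ∪ ⁅ b ⁆) k
      pointwise₁ k rewrite lookup-Δpair Y a b k | lookup-∪ X ⁅ b ⁆ k | lookup-X k | lookup-⁅⁆ b k with k ≟ a | k ≟ b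
      ... | yes refl | yes refl = ⊥-elim (a≢b refl)
      ... | yes refl | no _     rewrite Ya = refl
      ... | no _     | yes refl rewrite Yb = refl
      ... | no _     | no _     = trans (xor-identityʳ _) (sym (trans (∨-identityʳ _) (∧-identityʳ _)))
      pointwise₂ : ∀ k → lookup Y k ≡ lookup (X ∪ ⁅ a ⁆) k
      pointwise₂ k rewrite lookup-∪ X ⁅ a ⁆ k | lookup-X k | lookup-⁅⁆ a k with k ≟ a
      ... | yes refl rewrite Ya = refl
      ... | no _     = sym (trans (∨-identityʳ _) (∧-identityʳ _))

≐-sym : ∀ {n} {𝓕 𝓖 : Family n} → 𝓕 ≐ 𝓖 → 𝓖 ≐ 𝓕
≐-sym 𝓕≐𝓖 Y = proj₂ (𝓕≐𝓖 Y) , proj₁ (𝓕≐𝓖 Y)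

≐-trans : ∀ {n} {𝓕 𝓖 𝓗 : Family n} → 𝓕 ≐ 𝓖 → 𝓖 ≐ 𝓗 → 𝓕 ≐ 𝓗
≐-trans 𝓕≐𝓖 𝓖≐𝓗 Y = proj₁ (𝓖≐𝓗 Y) ∘ proj₁ (𝓕≐𝓖 Y) , proj₂ (𝓕≐𝓖 Y) ∘ proj₂ (𝓖≐𝓗 Y)

handleSlide-inactive : ∀ {n} (a b : Fin n) (𝓖 𝓗 : Family n) Y → ¬ slideSet a b 𝓖 Y → 𝓗 Y ⇔ 𝓖 Y →
  (handleSlide a b 𝓖 Y → 𝓗 Y) × (𝓗 Y → handleSlide a b 𝓖 Y)
handleSlide-inactive a b 𝓖 𝓗 Y ¬slide 𝓗⇔𝓖 =
  (λ { (inj₁ (g , _)) → Equivalence.from 𝓗⇔𝓖 g ; (inj₂ (s , _)) → ⊥-elim (¬slide s) }) ,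
  (λ h → inj₁ (Equivalence.to 𝓗⇔𝓖 h , ¬slide))

handleSlide-characterization : ∀ {n} (a b : Fin n) → a ≢ b → (𝓖 𝓗 : Family n) →
  (∀ Y → lookup Y a ≡ true → lookup Y b ≡ false →
     XorReflected (𝓖 Y) (𝓖 (Y Δ (⁅ a ⁆ ∪ ⁅ b ⁆))) (𝓗 Y)) →
  (∀ Y → lookup Y a ≡ false ⊎ lookup Y b ≡ true → 𝓗 Y ⇔ 𝓖 Y) →
  handleSlide a b 𝓖 ≐ 𝓗
handleSlide-characterization a b a≢b 𝓖 𝓗 active inactive Y with lookup Y a in Ya | lookup Y b in Yb
... | true  | false = sound , complete
  where
    toQ : slideSet a b 𝓖 Y → 𝓖 (Y Δ (⁅ a ⁆ ∪ ⁅ b ⁆))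
    toQ = proj₂ ∘ proj₂ ∘ slideSet⇒ a b a≢b 𝓖 Y
    fromQ : 𝓖 (Y Δ (⁅ a ⁆ ∪ ⁅ b ⁆)) → slideSet a b 𝓖 Y
    fromQ q = ⇒slideSet a b a≢b 𝓖 Y (Ya , Yb , q)
    𝓗⇔ : 𝓗 Y ⇔ ((𝓖 Y × ¬ 𝓖 (Y Δ (⁅ a ⁆ ∪ ⁅ b ⁆))) ⊎ (𝓖 (Y Δ (⁅ a ⁆ ∪ ⁅ b ⁆)) × ¬ 𝓖 Y))
    𝓗⇔ = XorReflected⇒⇔ (active Y Ya Yb)
    sound : handleSlide a b 𝓖 Y → 𝓗 Y
    sound (inj₁ (g , ¬s)) = Equivalence.from 𝓗⇔ (inj₁ (g , ¬s ∘ fromQ))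
    sound (inj₂ (s , ¬g)) = Equivalence.from 𝓗⇔ (inj₂ (toQ s , ¬g))
    complete : 𝓗 Y → handleSlide a b 𝓖 Y
    complete h with Equivalence.to 𝓗⇔ h
    ... | inj₁ (g , ¬q) = inj₁ (g , ¬q ∘ toQ)
    ... | inj₂ (q , ¬g) = inj₂ (fromQ q , ¬g)
... | false | _     = handleSlide-inactive a b 𝓖 𝓗 Y (λ s → bit-conflict (proj₁ (slideSet⇒ a b a≢b 𝓖 Y s)) Ya)
                                             (inactive Y (inj₁ Ya))
... | true  | true  = handleSlide-inactive a b 𝓖 𝓗 Y (λ s → bit-conflict Yb (proj₁ (proj₂ (slideSet⇒ a b a≢b 𝓖 Y s))))
                                             (inactive Y (inj₂ Yb))

∖-swap : ∀ {n} {w w′ : Bits n} {a b} → (∀ k → k ≢ a → k ≢ b → w′ k ≡ w k) → w′ a ≡ false → w b ≡ false → w′ ∖ b ≗ w ∖ a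
∖-swap {w = w} {w′} {a} {b} agree w′a wb k with k ≟ a | k ≟ b
... | yes refl | yes refl = trans (cong (_∧ false) w′a) (cong (_∧ false) (sym wb))
... | yes refl | no _     = trans (cong (_∧ true) w′a) (sym (∧-zeroʳ (w k)))
... | no _     | yes refl = trans (∧-zeroʳ (w′ k)) (cong (_∧ true) (sym wb))
... | no k≢a   | no k≢b   = cong (_∧ true) (agree k k≢a k≢b)

∖∖-≗ : ∀ {n} {w w′ : Bits n} {a b} → (∀ k → k ≢ a → k ≢ b → w′ k ≡ w k) → w′ a ≡ false → w′ b ≡ false →
  w′ ≗ (w ∖ a) ∖ b
∖∖-≗ {w = w} {w′} {a} {b} agree w′a w′b k with k ≟ a | k ≟ b
... | yes refl | _        = trans w′a (sym (truth-table 2 (λ p c → (p ∧ false) ∧ c) (λ _ _ → false) _ (w k) _))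
... | no _     | yes refl = trans w′b (sym (∧-zeroʳ _))
... | no k≢a   | no k≢b   = trans (agree k k≢a k≢b) (sym (trans (∧-identityʳ _) (∧-identityʳ _)))

module _ {n} (F : Subset n) where

  support : Subset n → Bits n
  support Y i = lookup F i xor lookup Y i

  family : Matrix n → Family n
  family A Y = NonsingularOn A (support Y)

  twist≐family : (A : Matrix n) → twist F (𝓓 A) ≐ family A
  twist≐family A Y = sound , complete
    where
      FΔFΔ : ∀ Z i → lookup F i xor lookup (F Δ Z) i ≡ lookup Z i
      FΔFΔ Z i = trans (cong (lookup F i xor_) (lookup-Δ F Z i))
                       (truth-table 2 (λ f z → f xor (f xor z)) (λ _ z → z) _ (lookup F i) (lookup Z i))
      sound : twist F (𝓓 A) Y → family A Y
      sound (X , invertible , refl) = NonsingularOn-cong (λ i → sym (FΔFΔ X i)) (λ _ _ _ _ → refl) (invertible⇒nonsingular A X invertible)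
      complete : family A Y → twist F (𝓓 A) Y
      complete nonsingular = F Δ Y ,
        nonsingular⇒invertible A (F Δ Y) (NonsingularOn-cong (λ i → sym (lookup-Δ F Y i)) (λ _ _ _ _ → refl) nonsingular) ,
        Subset-ext (λ i → sym (trans (lookup-Δ F (F Δ Y) i) (FΔFΔ Y i)))

  support-Δpair-off : ∀ Y {a b k} → k ≢ a → k ≢ b → support (Y Δ (⁅ a ⁆ ∪ ⁅ b ⁆)) k ≡ support Y k
  support-Δpair-off Y {a} {b} {k} k≢a k≢b rewrite lookup-Δpair Y a b k | δ-≢ k≢a | δ-≢ k≢b =
    cong (lookup F k xor_) (xor-identityʳ (lookup Y k))

  support-Δpair-a : ∀ Y {a b} → a ≢ b → support (Y Δ (⁅ a ⁆ ∪ ⁅ b ⁆)) a ≡ not (support Y a)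
  support-Δpair-a Y {a} {b} a≢b rewrite lookup-Δpair Y a b a | δ-refl a =
    truth-table 2 (λ f y → f xor (y xor true)) (λ f y → not (f xor y)) _ (lookup F a) (lookup Y a)

  support-Δpair-b : ∀ Y {a b} → a ≢ b → support (Y Δ (⁅ a ⁆ ∪ ⁅ b ⁆)) b ≡ not (support Y b)
  support-Δpair-b Y {a} {b} a≢b rewrite lookup-Δpair Y a b b | δ-refl b | δ-≢ (a≢b ∘ sym) =
    truth-table 2 (λ f y → f xor (y xor true)) (λ f y → not (f xor y)) _ (lookup F b) (lookup Y b)

  private
    _Δ⦅_,_⦆ : Subset n → Fin n → Fin n → Subset n
    Y Δ⦅ a , b ⦆ = Y Δ (⁅ a ⁆ ∪ ⁅ b ⁆)

  slide-outside : ∀ a b (A : Matrix n) → Symmetric A → a ≢ b → lookup F a ≡ false → lookup F b ≡ false →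
    handleSlide a b (family A) ≐ family (addRowCol a b A)
  slide-outside a b A A-sym a≢b Fa Fb = handleSlide-characterization a b a≢b (family A) (family (addRowCol a b A)) active inactive
    where
      active : ∀ Y → lookup Y a ≡ true → lookup Y b ≡ false →
        XorReflected (family A Y) (family A (Y Δ⦅ a , b ⦆)) (family (addRowCol a b A) Y)
      active Y Ya Yb = addRowCol-xor a b A A-sym a≢b (support Y) (support (Y Δ⦅ a , b ⦆)) wa
        (trans (support-Δpair-b Y a≢b) (cong not wb))
        (∖-swap (λ k k≢a k≢b → support-Δpair-off Y k≢a k≢b) (trans (support-Δpair-a Y a≢b) (cong not wa)) wb)
        where
          wa : support Y a ≡ true
          wa = cong₂ _xor_ Fa Ya
          wb : support Y b ≡ false
          wb = cong₂ _xor_ Fb Yb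
      inactive : ∀ Y → lookup Y a ≡ false ⊎ lookup Y b ≡ true → family (addRowCol a b A) Y ⇔ family A Y
      inactive Y (inj₁ Ya) = addRowCol-away a b A (support Y) (cong₂ _xor_ Fa Ya)
      inactive Y (inj₂ Yb) with lookup Y a in Ya
      ... | false = addRowCol-away a b A (support Y) (cong₂ _xor_ Fa Ya)
      ... | true  = addRowCol-inside a b A (support Y) a≢b (cong₂ _xor_ Fa Ya) (cong₂ _xor_ Fb Yb)

  slide-inside : ∀ a b (A : Matrix n) → Symmetric A → a ≢ b → lookup F a ≡ true → lookup F b ≡ true →
    handleSlide a b (family A) ≐ family (addRowCol b a A)
  slide-inside a b A A-sym a≢b Fa Fb = handleSlide-characterization a b a≢b (family A) (family (addRowCol b a A)) active inactive
    where
      b≢a : b ≢ a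
      b≢a = a≢b ∘ sym
      active : ∀ Y → lookup Y a ≡ true → lookup Y b ≡ false →
        XorReflected (family A Y) (family A (Y Δ⦅ a , b ⦆)) (family (addRowCol b a A) Y)
      active Y Ya Yb = addRowCol-xor b a A A-sym b≢a (support Y) (support (Y Δ⦅ a , b ⦆)) wb
        (trans (support-Δpair-a Y a≢b) (cong not wa))
        (∖-swap (λ k k≢b k≢a → support-Δpair-off Y k≢a k≢b) (trans (support-Δpair-b Y a≢b) (cong not wb)) wa)
        where
          wa : support Y a ≡ false
          wa = cong₂ _xor_ Fa Ya
          wb : support Y b ≡ true
          wb = cong₂ _xor_ Fb Yb
      inactive : ∀ Y → lookup Y a ≡ false ⊎ lookup Y b ≡ true → family (addRowCol b a A) Y ⇔ family A Y
      inactive Y (inj₂ Yb) = addRowCol-away b a A (support Y) (cong₂ _xor_ Fb Yb)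
      inactive Y (inj₁ Ya) with lookup Y b in Yb
      ... | true  = addRowCol-away b a A (support Y) (cong₂ _xor_ Fb Yb)
      ... | false = addRowCol-inside b a A (support Y) b≢a (cong₂ _xor_ Fb Yb) (cong₂ _xor_ Fa Ya)

  slide-across : ∀ a b (A : Matrix n) → Symmetric A → a ≢ b → lookup F a ≡ false → lookup F b ≡ true →
    handleSlide a b (family A) ≐ family (toggle a b A)
  slide-across a b A A-sym a≢b Fa Fb = handleSlide-characterization a b a≢b (family A) (family (toggle a b A)) active inactive
    where
      active : ∀ Y → lookup Y a ≡ true → lookup Y b ≡ false →
        XorReflected (family A Y) (family A (Y Δ⦅ a , b ⦆)) (family (toggle a b A) Y)
      active Y Ya Yb = toggle-xor a b A A-sym a≢b (support Y) (support (Y Δ⦅ a , b ⦆)) wa wb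
        (∖∖-≗ (λ k k≢a k≢b → support-Δpair-off Y k≢a k≢b)
                 (trans (support-Δpair-a Y a≢b) (cong not wa)) (trans (support-Δpair-b Y a≢b) (cong not wb)))
        where
          wa : support Y a ≡ true
          wa = cong₂ _xor_ Fa Ya
          wb : support Y b ≡ true
          wb = cong₂ _xor_ Fb Yb
      inactive : ∀ Y → lookup Y a ≡ false ⊎ lookup Y b ≡ true → family (toggle a b A) Y ⇔ family A Y
      inactive Y (inj₁ Ya) = toggle-away a b A (support Y) (inj₁ (cong₂ _xor_ Fa Ya))
      inactive Y (inj₂ Yb) = toggle-away a b A (support Y) (inj₂ (cong₂ _xor_ Fb Yb))

slideSet-≐ : ∀ {n} a b {𝓕 𝓖 : Family n} → 𝓕 ≐ 𝓖 → ∀ Y → slideSet a b 𝓕 Y → slideSet a b 𝓖 Y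
slideSet-≐ a b 𝓕≐𝓖 Y (X , X⊆ , 𝓕X , Y≡) = X , X⊆ , proj₁ (𝓕≐𝓖 _) 𝓕X , Y≡

handleSlide-≐ : ∀ {n} a b {𝓕 𝓖 : Family n} → 𝓕 ≐ 𝓖 → handleSlide a b 𝓕 ≐ handleSlide a b 𝓖
handleSlide-≐ a b 𝓕≐𝓖 Y = transport 𝓕≐𝓖 , transport (≐-sym 𝓕≐𝓖)
  where
    transport : ∀ {𝓕 𝓖} → 𝓕 ≐ 𝓖 → handleSlide a b 𝓕 Y → handleSlide a b 𝓖 Y
    transport 𝓕≐𝓖 (inj₁ (f , ¬s)) = inj₁ (proj₁ (𝓕≐𝓖 Y) f , ¬s ∘ slideSet-≐ a b (≐-sym 𝓕≐𝓖) Y)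
    transport 𝓕≐𝓖 (inj₂ (s , ¬f)) = inj₂ (slideSet-≐ a b 𝓕≐𝓖 Y s , ¬f ∘ proj₂ (𝓕≐𝓖 Y))

applySlides-++ : ∀ {n} (s t : List (Fin n × Fin n)) (𝓕 : Family n) → applySlides (s ++ t) 𝓕 ≡ applySlides t (applySlides s 𝓕)
applySlides-++ []            t 𝓕 = refl
applySlides-++ ((a , b) ∷ s) t 𝓕 = applySlides-++ s t (handleSlide a b 𝓕)

ValidSlides-++ : ∀ {n} (s t : List (Fin n × Fin n)) → ValidSlides s → ValidSlides t → ValidSlides (s ++ t)
ValidSlides-++ []            t _           valid-t = valid-t
ValidSlides-++ ((a , b) ∷ s) t (a≢b , valid-s) valid-t = a≢b , ValidSlides-++ s t valid-s valid-t

module Reachability {n} (F : Subset n) where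

  infix 4 _↝_

  _↝_ : Matrix n → Matrix n → Set₁
  A ↝ A′ = Σ (List (Fin n × Fin n)) λ s → ValidSlides s × (∀ (𝓕 : Family n) → 𝓕 ≐ family F A → applySlides s 𝓕 ≐ family F A′)

  ↝-refl : ∀ A → A ↝ A
  ↝-refl A = [] , tt , λ _ 𝓕≐ → 𝓕≐

  ↝-trans : ∀ {A B C} → A ↝ B → B ↝ C → A ↝ C
  ↝-trans (s , valid-s , s-maps) (t , valid-t , t-maps) = s ++ t , ValidSlides-++ s t valid-s valid-t ,
    λ 𝓕 𝓕≐ → subst (_≐ _) (sym (applySlides-++ s t 𝓕)) (t-maps (applySlides s 𝓕) (s-maps 𝓕 𝓕≐))

  ↝-cong : ∀ {A B C} → (∀ i j → B i j ≡ C i j) → A ↝ B → A ↝ C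
  ↝-cong B≡C (s , valid-s , s-maps) = s , valid-s , λ 𝓕 𝓕≐ →
    ≐-trans (s-maps 𝓕 𝓕≐) (λ Y → NonsingularOn-cong (λ _ → refl) (λ i j _ _ → B≡C i j) ,
                                  NonsingularOn-cong (λ _ → refl) (λ i j _ _ → sym (B≡C i j)))

  single-slide : ∀ {A B} a b → a ≢ b → handleSlide a b (family F A) ≐ family F B → A ↝ B
  single-slide a b a≢b slide = (a , b) ∷ [] , (a≢b , tt) , λ 𝓕 𝓕≐ → ≐-trans (handleSlide-≐ a b 𝓕≐) slide

  ↝addRowCol : ∀ A → Symmetric A → ∀ a b → a ≢ b → lookup F a ≡ lookup F b → A ↝ addRowCol a b A
  ↝addRowCol A A-sym a b a≢b same with lookup F a in Fa | lookup F b in Fb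
  ↝addRowCol A A-sym a b a≢b refl | false | false = single-slide a b a≢b (slide-outside F a b A A-sym a≢b Fa Fb)
  ↝addRowCol A A-sym a b a≢b refl | true  | true  = single-slide b a (a≢b ∘ sym) (slide-inside F b a A A-sym (a≢b ∘ sym) Fb Fa)

  ↝toggle : ∀ A → Symmetric A → ∀ a b → a ≢ b → lookup F a ≡ not (lookup F b) → A ↝ toggle a b A
  ↝toggle A A-sym a b a≢b opposite with lookup F a in Fa | lookup F b in Fb
  ↝toggle A A-sym a b a≢b refl | false | true  = single-slide a b a≢b (slide-across F a b A A-sym a≢b Fa Fb)
  ↝toggle A A-sym a b a≢b refl | true  | false =
    ↝-cong (toggle-comm a b A) (single-slide b a (a≢b ∘ sym) (slide-across F b a A A-sym (a≢b ∘ sym) Fb Fa))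

-- Reduction to normal form

_∪ᵇ_ : ∀ {n} → Bits n → Bits n → Bits n
(P ∪ᵇ Q) k = P k ∨ Q k

∪ᵇ-introˡ : ∀ {n} (P Q : Bits n) {k} → P k ≡ true → (P ∪ᵇ Q) k ≡ true
∪ᵇ-introˡ P Q Pk rewrite Pk = refl

∪ᵇ-introʳ : ∀ {n} (P Q : Bits n) {k} → Q k ≡ true → (P ∪ᵇ Q) k ≡ true
∪ᵇ-introʳ P Q {k} Qk rewrite Qk = ∨-zeroʳ (P k)

∪ᵇ-elim : ∀ {n} (P Q : Bits n) {k} → (P ∪ᵇ Q) k ≡ true → P k ≡ true ⊎ Q k ≡ true
∪ᵇ-elim P Q {k} P∪Q with P k
... | true  = inj₁ refl
... | false = inj₂ P∪Q

module NormalForm {n} (F : Subset n) where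

  open Reachability F

  side : Fin n → Bool
  side = lookup F

  AtMostEntry : Matrix n → Fin n → Fin n → Set
  AtMostEntry A m j = ∀ k → A m k ≡ true → k ≡ j

  record RowNormal (A : Matrix n) (R : Bits n) (m : Fin n) : Set where
    field
      inside   : ∀ j → A m j ≡ true → R j ≡ true
      single   : ∀ j k → A m j ≡ true → A m k ≡ true → j ≡ k
      sameSide : ∀ j → A m j ≡ true → side j ≡ side m

  record Normalised (A : Matrix n) (P : Bits n) : Set where
    field
      symmetric : Symmetric A
      rowNormal : ∀ m → P m ≡ true → RowNormal A P m

  open RowNormal public
  open Normalised public

  RowNormal-mono : ∀ {A R R′ m} → R ⊆ᵇ R′ → RowNormal A R m → RowNormal A R′ m
  RowNormal-mono R⊆R′ row = record { inside = λ j a → R⊆R′ j (inside row j a) ; single = single row ; sameSide = sameSide row }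

  RowNormal-onto : ∀ {A R m} j → AtMostEntry A m j → R j ≡ true → side j ≡ side m → RowNormal A R m
  RowNormal-onto {R = R} j only Rj side-j = record
    { inside   = λ k a → subst (λ k → R k ≡ true) (sym (only k a)) Rj
    ; single   = λ k l ak al → trans (only k ak) (sym (only l al))
    ; sameSide = λ k a → subst (λ k → side k ≡ _) (sym (only k a)) side-j }

  Normalised-extend : ∀ {A P} (Q : Bits n) → Normalised A P → (∀ m → Q m ≡ true → RowNormal A (P ∪ᵇ Q) m) →
    Normalised A (P ∪ᵇ Q)
  Normalised-extend {A} {P} Q normal new = record { symmetric = symmetric normal ; rowNormal = row }
    where
      row : ∀ m → (P ∪ᵇ Q) m ≡ true → RowNormal A (P ∪ᵇ Q) m
      row m Pm∨Qm with ∪ᵇ-elim P Q Pm∨Qm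
      ... | inj₁ Pm = RowNormal-mono (λ k → ∪ᵇ-introˡ P Q) (rowNormal normal m Pm)
      ... | inj₂ Qm = new m Qm

  Normalised-transfer : ∀ {A A′ P} → Normalised A P → Symmetric A′ → (∀ m j → P m ≡ true → A′ m j ≡ A m j) → Normalised A′ P
  Normalised-transfer {A} {A′} {P} normal sym′ same = record { symmetric = sym′ ; rowNormal = λ m Pm → transport m Pm (rowNormal normal m Pm) }
    where
      transport : ∀ m → P m ≡ true → RowNormal A P m → RowNormal A′ P m
      transport m Pm row = record
        { inside   = λ j a → inside row j (trans (sym (same m j Pm)) a)
        ; single   = λ j k a b → single row j k (trans (sym (same m j Pm)) a) (trans (sym (same m k Pm)) b)
        ; sameSide = λ j a → sameSide row j (trans (sym (same m j Pm)) a) }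

  unprocessed-row-vanishes : ∀ {A P i k} → Normalised A P → P i ≡ false → P k ≡ true → A i k ≡ false
  unprocessed-row-vanishes {A} {P} {i} {k} normal Pi Pk =
    ≢true⇒≡false (λ Aik → bit-conflict (inside (rowNormal normal k Pk) i (trans (symmetric normal k i) Aik)) Pi)

  ≢-by-processing : ∀ {P : Bits n} {m c} → P m ≡ true → P c ≡ false → m ≢ c
  ≢-by-processing Pm Pc refl = bit-conflict Pm Pc

  addRowCol-Normalised : ∀ {A P} c d → Normalised A P → P c ≡ false → P d ≡ false → c ≢ d → Normalised (addRowCol c d A) P
  addRowCol-Normalised {A} {P} c d normal Pc Pd c≢d = Normalised-transfer normal (addRowCol-sym c d A (symmetric normal)) unchanged
    where
      unchanged : ∀ m j → P m ≡ true → addRowCol c d A m j ≡ A m j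
      unchanged m j Pm = addRowCol-row-unchanged c d A j (≢-by-processing Pm Pc)
                           (≢true⇒≡false (λ Amd → bit-conflict (inside (rowNormal normal m Pm) d Amd) Pd))

  toggle-Normalised : ∀ {A P} c d → Normalised A P → P c ≡ false → P d ≡ false → Normalised (toggle c d A) P
  toggle-Normalised {A} c d normal Pc Pd = Normalised-transfer normal (toggle-sym c d A (symmetric normal))
    (λ m j Pm → toggle-row c d A j (≢-by-processing Pm Pc) (≢-by-processing Pm Pd))

  Step : (Matrix n → Set) → Fin n → Matrix n → Fin n → Set₁
  Step Good r A k = Σ (Matrix n) λ A′ → A ↝ A′ × Good A′ × A′ r k ≡ false × (∀ k′ → k′ ≢ k → A′ r k′ ≡ A r k′)

  module ClearRow (r : Fin n) {Target : Fin n → Set} (target? : Decidable Target) (Good : Matrix n → Set)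
                  (step : ∀ A k → Good A → Target k → A r k ≡ true → Step Good r A k) where

    clearList : (ks : List (Fin n)) → ∀ A → Good A →
      Σ (Matrix n) λ A′ → A ↝ A′ × Good A′ × (∀ k → k ∈ˡ ks → Target k → A′ r k ≡ false)
    clearList []       A good = A , ↝-refl A , good , λ _ ()
    clearList (k ∷ ks) A good with clearList ks A good
    ... | A₁ , A↝A₁ , good₁ , cleared₁ with target? k | A₁ r k in A₁rk
    ... | no ¬target | _ = A₁ , A↝A₁ , good₁ , λ { k′ (here refl) target → ⊥-elim (¬target target) ; k′ (there k′∈ks) → cleared₁ k′ k′∈ks }
    ... | yes _      | false = A₁ , A↝A₁ , good₁ , λ { k′ (here refl) _ → A₁rk ; k′ (there k′∈ks) → cleared₁ k′ k′∈ks }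
    ... | yes target | true with step A₁ k good₁ target A₁rk
    ... | A₂ , A₁↝A₂ , good₂ , A₂rk , others = A₂ , ↝-trans A↝A₁ A₁↝A₂ , good₂ , cleared₂
      where
        cleared₂ : ∀ k′ → k′ ∈ˡ (k ∷ ks) → Target k′ → A₂ r k′ ≡ false
        cleared₂ k′ k′∈ target′ with k′ ≟ k | k′∈
        ... | yes refl | _            = A₂rk
        ... | no k′≢k  | here k′≡k    = ⊥-elim (k′≢k k′≡k)
        ... | no k′≢k  | there k′∈ks  = trans (others k′ k′≢k) (cleared₁ k′ k′∈ks target′)

    clear : ∀ A → Good A → Σ (Matrix n) λ A′ → A ↝ A′ × Good A′ × (∀ k → Target k → A′ r k ≡ false)
    clear A good with clearList (allFin n) A good
    ... | A′ , A↝A′ , good′ , cleared = A′ , A↝A′ , good′ , λ k → cleared k (∈-allFin k)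

  NoCross : Bits n → Fin n → Matrix n → Set
  NoCross P r A = ∀ k → P k ≡ false → A r k ≡ true → side k ≡ side r

  -- Entries A r k with k unprocessed and on the other side of F are removed by toggling them.
  module CrossClear (P : Bits n) (r : Fin n) (Pr : P r ≡ false) (Extra : Matrix n → Set)
    (keep : ∀ A k → Normalised A P → Extra A → P k ≡ false → side k ≢ side r → A r k ≡ true → Extra (toggle r k A)) where

    private
      Good : Matrix n → Set
      Good A = Normalised A P × Extra A

      Crossing : Fin n → Set
      Crossing k = P k ≡ false × side k ≢ side r

      crossing? : Decidable Crossing
      crossing? k = (P k ≟ᵇ false) ×-dec ¬? (side k ≟ᵇ side r)

      step : ∀ A k → Good A → Crossing k → A r k ≡ true → Step Good r A k
      step A k (normal , extra) (Pk , side≢) Ark =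
        toggle r k A , ↝toggle A (symmetric normal) r k r≢k (¬-not (side≢ ∘ sym)) ,
        (toggle-Normalised r k normal Pr Pk , keep A k normal extra Pk side≢ Ark) ,
        trans (toggle-pair r k A r≢k) (cong not Ark) , λ k′ k′≢k → toggle-rowᵃ r k A r≢k k′≢k
        where
          r≢k : r ≢ k
          r≢k refl = side≢ refl

    crossClear : ∀ A → Normalised A P → Extra A → Σ (Matrix n) λ A′ → A ↝ A′ × Normalised A′ P × Extra A′ × NoCross P r A′
    crossClear A normal extra with ClearRow.clear r crossing? Good step A (normal , extra)
    ... | A′ , A↝A′ , (normal′ , extra′) , cleared = A′ , A↝A′ , normal′ , extra′ , noCross
      where
        noCross : NoCross P r A′
        noCross k Pk A′rk with side k ≟ᵇ side r
        ... | yes same = same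
        ... | no side≢ = ⊥-elim (bit-conflict A′rk (cleared k (Pk , side≢)))

  -- Entries A r k with k ∉ {r, p} unprocessed are removed by adding row and column p to k, where A r p = 1.
  module PivotClear (P : Bits n) (r p : Fin n) (Pr : P r ≡ false) (Pp : P p ≡ false) (side-p : side p ≡ side r)
    (Extra : Matrix n → Set)
    (keep : ∀ A k → Normalised A P → Extra A → P k ≡ false → k ≢ r → k ≢ p → A r k ≡ true → Extra (addRowCol k p A)) where

    Good : Matrix n → Set
    Good A = Normalised A P × A r p ≡ true × NoCross P r A × Extra A

    private
      Clearable : Fin n → Set
      Clearable k = P k ≡ false × k ≢ r × k ≢ p

      clearable? : Decidable Clearable
      clearable? k = (P k ≟ᵇ false) ×-dec (¬? (k ≟ r) ×-dec ¬? (k ≟ p))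

      step : ∀ A k → Good A → Clearable k → A r k ≡ true → Step Good r A k
      step A k (normal , Arp , noCross , extra) (Pk , k≢r , k≢p) Ark =
        addRowCol k p A , ↝addRowCol A (symmetric normal) k p k≢p (trans (noCross k Pk Ark) (sym side-p)) ,
        (addRowCol-Normalised k p normal Pk Pp k≢p , trans (addRowCol-outside k p A r≢k p≢k) Arp ,
         (λ k′ Pk′ → noCross′ k′ Pk′ (k′ ≟ k)) , keep A k normal extra Pk k≢r k≢p Ark) ,
        cleared , λ k′ k′≢k → addRowCol-outside k p A r≢k k′≢k
        where
          r≢k : r ≢ k
          r≢k = k≢r ∘ sym
          p≢k : p ≢ k
          p≢k = k≢p ∘ sym
          cleared : addRowCol k p A r k ≡ false
          cleared = trans (addRowCol-column k p A r≢k) (cong₂ _xor_ Ark Arp)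
          noCross′ : ∀ k′ → P k′ ≡ false → Dec (k′ ≡ k) → addRowCol k p A r k′ ≡ true → side k′ ≡ side r
          noCross′ k′ Pk′ (yes refl) A′rk′ = ⊥-elim (bit-conflict A′rk′ cleared)
          noCross′ k′ Pk′ (no k′≢k)  A′rk′ = noCross k′ Pk′ (trans (sym (addRowCol-outside k p A r≢k k′≢k)) A′rk′)

    pivotClear : ∀ A → Good A → Σ (Matrix n) λ A′ → A ↝ A′ × Good A′ × (∀ k → A′ r k ≡ true → k ≡ r ⊎ k ≡ p)
    pivotClear A good with ClearRow.clear r clearable? Good step A good
    ... | A′ , A↝A′ , good′ , cleared = A′ , A↝A′ , good′ , onlyPivots
      where
        onlyPivots : ∀ k → A′ r k ≡ true → k ≡ r ⊎ k ≡ p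
        onlyPivots k A′rk with P k in Pk | k ≟ r | k ≟ p
        ... | true  | _        | _        = ⊥-elim (bit-conflict A′rk (unprocessed-row-vanishes (proj₁ good′) Pr Pk))
        ... | false | yes k≡r  | _        = inj₁ k≡r
        ... | false | no _     | yes k≡p  = inj₂ k≡p
        ... | false | no k≢r   | no k≢p   = ⊥-elim (bit-conflict A′rk (cleared k (Pk , k≢r , k≢p)))

  Processed : Matrix n → Bits n → Fin n → Set₁
  Processed A P i = Σ (Matrix n) λ A′ → A ↝ A′ × Σ (Bits n) λ P′ → Normalised A′ P′ × P ⊆ᵇ P′ × P′ i ≡ true

  Processed-pre : ∀ {A B P i} → A ↝ B → Processed B P i → Processed A P i
  Processed-pre A↝B (A′ , B↝A′ , rest) = A′ , ↝-trans A↝B B↝A′ , rest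

  module Process (P : Bits n) (i : Fin n) (Pi : P i ≡ false) where

    finishPair : ∀ A j → Normalised A P → AtMostEntry A i j → AtMostEntry A j i → side j ≡ side i →
      Processed A P i
    finishPair A j normal rowI rowJ side-j = A , ↝-refl A , P ∪ᵇ Q , Normalised-extend Q normal new , (λ k → ∪ᵇ-introˡ P Q) , Q⊆ Qi
      where
        Q : Bits n
        Q = basis i ∪ᵇ basis j
        Qi : Q i ≡ true
        Qi = ∪ᵇ-introˡ (basis i) (basis j) (δ-refl i)
        Qj : Q j ≡ true
        Qj = ∪ᵇ-introʳ (basis i) (basis j) (δ-refl j)
        Q⊆ : ∀ {k} → Q k ≡ true → (P ∪ᵇ Q) k ≡ true
        Q⊆ = ∪ᵇ-introʳ P Q
        new : ∀ m → Q m ≡ true → RowNormal A (P ∪ᵇ Q) m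
        new m Qm with ∪ᵇ-elim (basis i) (basis j) Qm
        ... | inj₁ δmi with basis-true {k = m} {i} δmi
        ...   | refl = RowNormal-onto j rowI (Q⊆ Qj) side-j
        new m Qm | inj₂ δmj with basis-true {k = m} {j} δmj
        ...   | refl = RowNormal-onto i rowJ (Q⊆ Qi) (sym side-j)

    finishSingle : ∀ A → Normalised A P → AtMostEntry A i i → Processed A P i
    finishSingle A normal rowI = finishPair A i normal rowI rowI refl

    diagonal : ∀ A → Normalised A P → A i i ≡ true → Processed A P i
    diagonal A normal Aii with CrossClear.crossClear P i Pi (λ A → A i i ≡ true) keep A normal Aii
      where
        keep : ∀ A k → Normalised A P → A i i ≡ true → P k ≡ false → side k ≢ side i → A i k ≡ true → toggle i k A i i ≡ true
        keep A k _ Aii _ side≢ _ = trans (toggle-rowᵃ i k A i≢k i≢k) Aii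
          where
            i≢k : i ≢ k
            i≢k refl = side≢ refl
    ... | A₁ , A↝A₁ , normal₁ , A₁ii , noCross₁
      with PivotClear.pivotClear P i i Pi Pi refl (λ _ → ⊤) (λ _ _ _ _ _ _ _ _ → tt) A₁ (normal₁ , A₁ii , noCross₁ , tt)
    ... | A₂ , A₁↝A₂ , (normal₂ , _) , onlyPivots =
      Processed-pre (↝-trans A↝A₁ A₁↝A₂) (finishSingle A₂ normal₂ (λ k A₂ik → [ id , id ] (onlyPivots k A₂ik)))

    clearPartnerRow : ∀ A j → Normalised A P → P j ≡ false → j ≢ i → side j ≡ side i →
      A j j ≡ false → A i j ≡ true → NoCross P j A → AtMostEntry A i j → Processed A P i
    clearPartnerRow A j normal Pj j≢i side-j Ajj Aij noCross-j rowI
      with PivotClear.pivotClear P j i Pj Pi (sym side-j) Extra keep A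
             (normal , trans (symmetric normal j i) Aij , noCross-j , (Ajj , rowI))
      where
        Extra : Matrix n → Set
        Extra A = A j j ≡ false × AtMostEntry A i j
        keep : ∀ A k → Normalised A P → Extra A → P k ≡ false → k ≢ j → k ≢ i → A j k ≡ true → Extra (addRowCol k i A)
        keep A k _ (Ajj , rowI) _ k≢j k≢i _ =
          trans (addRowCol-outside k i A (k≢j ∘ sym) (k≢j ∘ sym)) Ajj ,
          λ k′ a → rowI k′ (trans (sym (addRowCol-row-unchanged k i A k′ (k≢i ∘ sym) Aii≡false)) a)
          where
            Aii≡false : A i i ≡ false
            Aii≡false = ≢true⇒≡false (λ Aii → j≢i (sym (rowI i Aii)))
    ... | A′ , A↝A′ , (normal′ , _ , _ , (A′jj , rowI′)) , onlyPivots =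
      Processed-pre A↝A′ (finishPair A′ j normal′ rowI′ rowJ′ side-j)
      where
        rowJ′ : AtMostEntry A′ j i
        rowJ′ k A′jk with onlyPivots k A′jk
        ... | inj₁ refl = ⊥-elim (bit-conflict A′jk A′jj)
        ... | inj₂ k≡i  = k≡i

    clearBothRows : ∀ A j → Normalised A P → P j ≡ false → j ≢ i → side j ≡ side i →
      A i i ≡ false → A j j ≡ false → A i j ≡ true → NoCross P i A → NoCross P j A → Processed A P i
    clearBothRows A j normal Pj j≢i side-j Aii Ajj Aij noCross-i noCross-j
      with PivotClear.pivotClear P i j Pi Pj side-j Extra keep A (normal , Aij , noCross-i , (Aii , Ajj , noCross-j))
      where
        Extra : Matrix n → Set
        Extra A = A i i ≡ false × A j j ≡ false × NoCross P j A
        keep : ∀ A k → Normalised A P → Extra A → P k ≡ false → k ≢ i → k ≢ j → A i k ≡ true → Extra (addRowCol k j A)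
        keep A k _ (Aii , Ajj , noCross-j) _ k≢i k≢j _ =
          trans (addRowCol-outside k j A i≢k i≢k) Aii , trans (addRowCol-outside k j A j≢k j≢k) Ajj ,
          λ k′ Pk′ a → noCross-j k′ Pk′ (trans (sym (addRowCol-row-unchanged k j A k′ j≢k Ajj)) a)
          where
            i≢k : i ≢ k
            i≢k = k≢i ∘ sym
            j≢k : j ≢ k
            j≢k = k≢j ∘ sym
    ... | A′ , A↝A′ , (normal′ , A′ij , _ , (A′ii , A′jj , noCross-j′)) , onlyPivots =
      Processed-pre A↝A′ (clearPartnerRow A′ j normal′ Pj j≢i side-j A′jj A′ij noCross-j′ rowI′)
      where
        rowI′ : AtMostEntry A′ i j
        rowI′ k A′ik with onlyPivots k A′ik
        ... | inj₁ refl = ⊥-elim (bit-conflict A′ik A′ii)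
        ... | inj₂ k≡j  = k≡j

    pair : ∀ A j → Normalised A P → P j ≡ false → j ≢ i → side j ≡ side i →
      A i i ≡ false → A j j ≡ false → A i j ≡ true → NoCross P i A → Processed A P i
    pair A j normal Pj j≢i side-j Aii Ajj Aij noCross-i
      with CrossClear.crossClear P j Pj Extra keep A normal (Aii , Ajj , Aij , noCross-i)
      where
        i≢j : i ≢ j
        i≢j = j≢i ∘ sym
        Extra : Matrix n → Set
        Extra A = A i i ≡ false × A j j ≡ false × A i j ≡ true × NoCross P i A
        keep : ∀ A k → Normalised A P → Extra A → P k ≡ false → side k ≢ side j → A j k ≡ true → Extra (toggle j k A)
        keep A k _ (Aii , Ajj , Aij , noCross-i) _ side≢ _ =
          trans (toggle-row j k A i i≢j i≢k) Aii , trans (toggle-rowᵃ j k A j≢k j≢k) Ajj , trans (toggle-row j k A j i≢j i≢k) Aij ,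
          λ k′ Pk′ a → noCross-i k′ Pk′ (trans (sym (toggle-row j k A k′ i≢j i≢k)) a)
          where
            i≢k : i ≢ k
            i≢k refl = side≢ (sym side-j)
            j≢k : j ≢ k
            j≢k refl = side≢ refl
    ... | A′ , A↝A′ , normal′ , (A′ii , A′jj , A′ij , noCross-i′) , noCross-j′ =
      Processed-pre A↝A′ (clearBothRows A′ j normal′ Pj j≢i side-j A′ii A′jj A′ij noCross-i′ noCross-j′)

    -- A partner j with A j j = 1 is added to i to create a nonzero diagonal; otherwise i and j form a pair.
    zeroDiagonal : ∀ A → Normalised A P → A i i ≡ false → Processed A P i
    zeroDiagonal A normal Aii with CrossClear.crossClear P i Pi (λ A → A i i ≡ false) keep A normal Aii
      where
        keep : ∀ A k → Normalised A P → A i i ≡ false → P k ≡ false → side k ≢ side i → A i k ≡ true → toggle i k A i i ≡ false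
        keep A k _ Aii _ side≢ _ = trans (toggle-rowᵃ i k A i≢k i≢k) Aii
          where
            i≢k : i ≢ k
            i≢k refl = side≢ refl
    ... | A₁ , A↝A₁ , normal₁ , A₁ii , noCross₁ with any? (λ j → (P j ≟ᵇ false) ×-dec (A₁ i j ≟ᵇ true))
    ... | no none = Processed-pre A↝A₁ (finishSingle A₁ normal₁ rowZero)
      where
        rowZero : AtMostEntry A₁ i i
        rowZero k A₁ik with P k in Pk
        ... | true  = ⊥-elim (bit-conflict A₁ik (unprocessed-row-vanishes normal₁ Pi Pk))
        ... | false = ⊥-elim (none (k , Pk , A₁ik))
    ... | yes (j , Pj , A₁ij) with A₁ j j in A₁jj
    ...   | false = Processed-pre A↝A₁ (pair A₁ j normal₁ Pj j≢i side-j A₁ii A₁jj A₁ij noCross₁)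
      where
        j≢i : j ≢ i
        j≢i refl = bit-conflict A₁ij A₁ii
        side-j : side j ≡ side i
        side-j = noCross₁ j Pj A₁ij
    ...   | true  = Processed-pre (↝-trans A↝A₁ (↝addRowCol A₁ (symmetric normal₁) i j i≢j (sym side-j)))
                      (diagonal (addRowCol i j A₁) (addRowCol-Normalised i j normal₁ Pi Pj i≢j)
                                (trans (addRowCol-corner-sym i j A₁ (symmetric normal₁)) (cong₂ _xor_ A₁ii A₁jj)))
      where
        i≢j : i ≢ j
        i≢j refl = bit-conflict A₁ij A₁ii
        side-j : side j ≡ side i
        side-j = noCross₁ j Pj A₁ij

    process : ∀ A → Normalised A P → Processed A P i
    process A normal with A i i in Aii
    ... | true  = diagonal A normal Aii
    ... | false = zeroDiagonal A normal Aii

  normaliseList : (L : List (Fin n)) → ∀ A P → Normalised A P →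
    Σ (Matrix n) λ A′ → A ↝ A′ × Σ (Bits n) λ P′ → Normalised A′ P′ × P ⊆ᵇ P′ × (∀ k → k ∈ˡ L → P′ k ≡ true)
  normaliseList []      A P normal = A , ↝-refl A , P , normal , (λ _ Pk → Pk) , λ _ ()
  normaliseList (i ∷ L) A P normal with firstStep (P i) refl
    where
      firstStep : ∀ b → P i ≡ b → Processed A P i
      firstStep true  Pi = A , ↝-refl A , P , normal , (λ _ Pk → Pk) , Pi
      firstStep false Pi = Process.process P i Pi A normal
  ... | A₁ , A↝A₁ , P₁ , normal₁ , P⊆P₁ , P₁i with normaliseList L A₁ P₁ normal₁
  ... | A′ , A₁↝A′ , P′ , normal′ , P₁⊆P′ , covered =
    A′ , ↝-trans A↝A₁ A₁↝A′ , P′ , normal′ , (λ k → P₁⊆P′ k ∘ P⊆P₁ k) ,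
    λ { k (here refl) → P₁⊆P′ k P₁i ; k (there k∈L) → covered k k∈L }

  normalise : ∀ A → Symmetric A → Σ (Matrix n) λ N → A ↝ N × Normalised N (λ _ → true)
  normalise A A-sym with normaliseList (allFin n) A (λ _ → false) (record { symmetric = A-sym ; rowNormal = λ _ () })
  ... | N , A↝N , P , normal , _ , covered =
    N , A↝N , record { symmetric = symmetric normal ; rowNormal = λ m _ → RowNormal-mono (λ _ _ → refl) (rowNormal normal m (covered m (∈-allFin m))) }

-- Feasible sets of a normal form

⊆-card⇒≡ : ∀ {n} {p q : Subset n} → p ⊆ q → ∣ q ∣ ≤ ∣ p ∣ → p ≡ q
⊆-card⇒≡ {p = p} {q} p⊆q ∣q∣≤∣p∣ = ⊆-antisym p⊆q q⊆p
  where
    q⊆p : q ⊆ p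
    q⊆p {x} x∈q with x ∈? p
    ... | yes x∈p = x∈p
    ... | no  x∉p = contradiction (p⊂q⇒∣p∣<∣q∣ (p⊆q , x , x∈q , x∉p)) (≤⇒≯ ∣q∣≤∣p∣)

IsDeltaMatroid-≐ : ∀ {n} {𝓕 𝓖 : Family n} → 𝓕 ≐ 𝓖 → IsDeltaMatroid 𝓕 → IsDeltaMatroid 𝓖
IsDeltaMatroid-≐ 𝓕≐𝓖 ((F₀ , 𝓕F₀) , exchange) = (F₀ , proj₁ (𝓕≐𝓖 F₀) 𝓕F₀) , λ F₁ F₂ x 𝓖F₁ 𝓖F₂ x∈ →
  let (y , y∈ , 𝓕F₁′) = exchange F₁ F₂ x (proj₂ (𝓕≐𝓖 F₁) 𝓖F₁) (proj₂ (𝓕≐𝓖 F₂) 𝓖F₂) x∈ in y , y∈ , proj₁ (𝓕≐𝓖 _) 𝓕F₁′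

UniqueMin-≐ : ∀ {n} {𝓕 𝓖 : Family n} → 𝓕 ≐ 𝓖 → UniqueMin 𝓕 → UniqueMin 𝓖
UniqueMin-≐ 𝓕≐𝓖 (F₀ , 𝓕F₀ , least , unique) =
  F₀ , proj₁ (𝓕≐𝓖 F₀) 𝓕F₀ , (λ G 𝓖G → least G (proj₂ (𝓕≐𝓖 G) 𝓖G)) , λ G 𝓖G → unique G (proj₂ (𝓕≐𝓖 G) 𝓖G)

UniqueMax-≐ : ∀ {n} {𝓕 𝓖 : Family n} → 𝓕 ≐ 𝓖 → UniqueMax 𝓕 → UniqueMax 𝓖
UniqueMax-≐ 𝓕≐𝓖 (F₀ , 𝓕F₀ , greatest , unique) =
  F₀ , proj₁ (𝓕≐𝓖 F₀) 𝓕F₀ , (λ G 𝓖G → greatest G (proj₂ (𝓕≐𝓖 G) 𝓖G)) , λ G 𝓖G → unique G (proj₂ (𝓕≐𝓖 G) 𝓖G)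

module NormalFamily {n} (F : Subset n) (N : Matrix n) where

  open NormalForm F

  module _ (normal : Normalised N (λ _ → true)) where

    private
      partner-unique : ∀ {m j k} → N m j ≡ true → N m k ≡ true → j ≡ k
      partner-unique {m} {j} {k} = single (rowNormal normal m refl) j k

      N-sym : ∀ {i j} → N i j ≡ true → N j i ≡ true
      N-sym {i} {j} = trans (symmetric normal j i)

      partner-side : ∀ {i j} → N i j ≡ true → side j ≡ side i
      partner-side {i} {j} = sameSide (rowNormal normal i refl) j

    Matched : Bits n → Set
    Matched w = ∀ i → w i ≡ true → ∃ λ j → w j ≡ true × N i j ≡ true

    matched⇒nonsingular : ∀ w → Matched w → NonsingularOn N w
    matched⇒nonsingular w matched x (x⊆w , Nx≡0) k with x k in xk
    ... | false = refl
    ... | true with matched k (x⊆w k xk)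
    ...   | j , wj , Nkj = ⊥-elim (bit-conflict (trans Nxj (cong₂ _∧_ (N-sym Nkj) xk)) (Nx≡0 j wj))
      where
        Nxj : (N · x) j ≡ N j k ∧ x k
        Nxj = Σ₂-single (λ l → N j l ∧ x l) k off
          where
            off : ∀ l → l ≢ k → N j l ∧ x l ≡ false
            off l l≢k with N j l in Njl
            ... | false = refl
            ... | true  = ⊥-elim (l≢k (partner-unique Njl (N-sym Nkj)))

    nonsingular⇒matched : ∀ w → NonsingularOn N w → Matched w
    nonsingular⇒matched w nonsingular i wi with any? (λ j → (w j ≟ᵇ true) ×-dec (N i j ≟ᵇ true))
    ... | yes found = found
    ... | no  none  = ⊥-elim (bit-conflict (δ-refl i) (nonsingular (basis i) (basis⊆w , N·basis≡0) i))
      where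
        basis⊆w : basis i ⊆ᵇ w
        basis⊆w k δki = subst (λ k → w k ≡ true) (sym (basis-true δki)) wi
        N·basis≡0 : ∀ m → w m ≡ true → (N · basis i) m ≡ false
        N·basis≡0 m wm = trans (·-[↦] N i true m) (≢true⇒≡false (λ Nmi → none (m , wm , N-sym Nmi)))

    covered : Fin n → Bool
    covered k = does (any? (λ j → N k j ≟ᵇ true))

    covered-witness : ∀ {k} → covered k ≡ true → ∃ λ j → N k j ≡ true
    covered-witness {k} with any? (λ j → N k j ≟ᵇ true)
    ... | yes found = λ _ → found

    covered-intro : ∀ {k j} → N k j ≡ true → covered k ≡ true
    covered-intro {k} {j} Nkj = dec-true (any? (λ j → N k j ≟ᵇ true)) (j , Nkj)

    matched⇒covered : ∀ {w} → Matched w → ∀ k → w k ≡ true → covered k ≡ true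
    matched⇒covered matched k wk = covered-intro (proj₂ (proj₂ (matched k wk)))

    minimum maximum : Subset n
    minimum = tabulate (λ k → side k ∧ not (covered k))
    maximum = tabulate (λ k → side k ∨ covered k)

    support-minimum : ∀ k → support F minimum k ≡ side k ∧ covered k
    support-minimum k = trans (cong (side k xor_) (lookup∘tabulate (λ k → side k ∧ not (covered k)) k))
      (truth-table 2 (λ f c → f xor (f ∧ not c)) (λ f c → f ∧ c) _ (side k) (covered k))

    support-maximum : ∀ k → support F maximum k ≡ not (side k) ∧ covered k
    support-maximum k = trans (cong (side k xor_) (lookup∘tabulate (λ k → side k ∨ covered k) k))
      (truth-table 2 (λ f c → f xor (f ∨ c)) (λ f c → not f ∧ c) _ (side k) (covered k))

    covered-side-matched : (t : Bool → Bool) → Matched (λ k → t (side k) ∧ covered k)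
    covered-side-matched t k tk∧ck with t (side k) in tk | covered k in ck
    ... | true | true with covered-witness ck
    ...   | j , Nkj = j , trans (cong₂ _∧_ (trans (cong t (partner-side Nkj)) tk) (covered-intro (N-sym Nkj))) refl , Nkj

    minimum-feasible : family F N minimum
    minimum-feasible = NonsingularOn-cong (sym ∘ support-minimum) (λ _ _ _ _ → refl)
                         (matched⇒nonsingular _ (covered-side-matched (λ s → s)))

    maximum-feasible : family F N maximum
    maximum-feasible = NonsingularOn-cong (sym ∘ support-maximum) (λ _ _ _ _ → refl)
                         (matched⇒nonsingular _ (covered-side-matched not))

    feasible⇒covered : ∀ Y → family F N Y → ∀ k → support F Y k ≡ true → covered k ≡ true
    feasible⇒covered Y feasible = matched⇒covered (nonsingular⇒matched (support F Y) feasible)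

    minimum⊆ : ∀ Y → family F N Y → minimum ⊆ Y
    minimum⊆ Y feasible {k} k∈min = ∈-lookup (byCases (side k) (covered k) (lookup Y k) refl refl refl)
      where
        min-k : side k ∧ not (covered k) ≡ true
        min-k = trans (sym (lookup∘tabulate (λ k → side k ∧ not (covered k)) k)) (lookup-∈ k∈min)
        byCases : ∀ f c y → side k ≡ f → covered k ≡ c → lookup Y k ≡ y → lookup Y k ≡ true
        byCases f c true _ _ Yk = Yk
        byCases true false false fk ck Yk =
          ⊥-elim (bit-conflict (feasible⇒covered Y feasible k (cong₂ _xor_ fk Yk)) ck)
        byCases false c false fk _ _ = ⊥-elim (bit-conflict min-k (cong (_∧ not (covered k)) fk))
        byCases true true false fk ck _ = ⊥-elim (bit-conflict min-k (cong₂ (λ f c → f ∧ not c) fk ck))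

    ⊆maximum : ∀ Y → family F N Y → Y ⊆ maximum
    ⊆maximum Y feasible {k} k∈Y = ∈-lookup (trans (lookup∘tabulate (λ k → side k ∨ covered k) k) (byCases (side k) refl))
      where
        byCases : ∀ f → side k ≡ f → side k ∨ covered k ≡ true
        byCases true  fk = cong (_∨ covered k) fk
        byCases false fk = trans (cong (_∨ covered k) fk)
                                 (feasible⇒covered Y feasible k (cong₂ _xor_ fk (lookup-∈ k∈Y)))

    uniqueMin : UniqueMin (family F N)
    uniqueMin = minimum , minimum-feasible ,
      (λ Y feasible → p⊆q⇒∣p∣≤∣q∣ (minimum⊆ Y feasible)) , λ Y feasible ∣Y∣≤ → sym (⊆-card⇒≡ (minimum⊆ Y feasible) ∣Y∣≤)

    uniqueMax : UniqueMax (family F N)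
    uniqueMax = maximum , maximum-feasible ,
      (λ Y feasible → p⊆q⇒∣p∣≤∣q∣ (⊆maximum Y feasible)) , λ Y feasible ∣max∣≤ → ⊆-card⇒≡ (⊆maximum Y feasible) ∣max∣≤

    module Exchange (F₁ F₂ : Subset n) (x : Fin n) (feasible₁ : family F N F₁) (feasible₂ : family F N F₂)
                    (x∈ : lookup (F₁ Δ F₂) x ≡ true) where

      w₁ w₂ : Bits n
      w₁ = support F F₁
      w₂ = support F F₂

      matched₁ : Matched w₁
      matched₁ = nonsingular⇒matched w₁ feasible₁
      matched₂ : Matched w₂
      matched₂ = nonsingular⇒matched w₂ feasible₂

      lookup-F₁ΔF₂ : ∀ k → lookup (F₁ Δ F₂) k ≡ w₁ k xor w₂ k
      lookup-F₁ΔF₂ k = trans (lookup-Δ F₁ F₂ k)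
        (truth-table 3 (λ f a b → a xor b) (λ f a b → (f xor a) xor (f xor b)) _ (side k) (lookup F₁ k) (lookup F₂ k))

      module _ (y : Fin n) where

        w′ : Bits n
        w′ k = w₁ k xor (δ k x ∨ δ k y)

        support-eq : ∀ k → support F (F₁ Δ (⁅ x ⁆ ∪ ⁅ y ⁆)) k ≡ w′ k
        support-eq k = trans (cong (side k xor_) (lookup-Δpair F₁ x y k))
          (truth-table 3 (λ f a d → f xor (a xor d)) (λ f a d → (f xor a) xor d) _ (side k) (lookup F₁ k) (δ k x ∨ δ k y))

        w′-x : w′ x ≡ not (w₁ x)
        w′-x rewrite δ-refl x = truth-table 1 (λ p → p xor true) not _ (w₁ x)

        w′-y : w′ y ≡ not (w₁ y)
        w′-y rewrite δ-refl y | ∨-zeroʳ (δ y x) = truth-table 1 (λ p → p xor true) not _ (w₁ y)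

        w′-other : ∀ {k} → k ≢ x → k ≢ y → w′ k ≡ w₁ k
        w′-other {k} k≢x k≢y rewrite δ-≢ k≢x | δ-≢ k≢y = xor-identityʳ (w₁ k)

        feasible′ : Matched w′ → family F N (F₁ Δ (⁅ x ⁆ ∪ ⁅ y ⁆))
        feasible′ matched = NonsingularOn-cong (sym ∘ support-eq) (λ _ _ _ _ → refl) (matched⇒nonsingular w′ matched)

      Exchanged : Set
      Exchanged = ∃ λ y → y ∈ (F₁ Δ F₂) × family F N (F₁ Δ (⁅ x ⁆ ∪ ⁅ y ⁆))

      -- x ∈ support F₁: remove x and its partner y from the matched support.
      leaving : w₁ x ≡ true → Exchanged
      leaving w₁x with matched₁ x w₁x
      ... | y , w₁y , Nxy = y , ∈-lookup (trans (lookup-F₁ΔF₂ y) (cong₂ _xor_ w₁y w₂y)) , feasible′ y matched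
        where
          w₂x : w₂ x ≡ false
          w₂x = not-injective (trans (sym (cong (_xor w₂ x) w₁x)) (trans (sym (lookup-F₁ΔF₂ x)) x∈))
          w₂y : w₂ y ≡ false
          w₂y = ≢true⇒≡false (λ w₂y → let (z , w₂z , Nyz) = matched₂ y w₂y in
                  bit-conflict (subst (λ z → w₂ z ≡ true) (sym (partner-unique (N-sym Nxy) Nyz)) w₂z) w₂x)
          matched : Matched (w′ y)
          matched k = byCases (k ≟ x) (k ≟ y)
            where
            byCases : Dec (k ≡ x) → Dec (k ≡ y) → w′ y k ≡ true → ∃ λ j → w′ y j ≡ true × N k j ≡ true
            byCases (yes refl) _          w′k = ⊥-elim (bit-conflict w′k (trans (w′-x y) (cong not w₁x)))
            byCases (no _)     (yes refl) w′k = ⊥-elim (bit-conflict w′k (trans (w′-y y) (cong not w₁y)))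
            byCases (no k≢x)   (no k≢y)   w′k with matched₁ k (trans (sym (w′-other y k≢x k≢y)) w′k)
            ... | j , w₁j , Nkj = j , trans (w′-other y j≢x j≢y) w₁j , Nkj
              where
              j≢x : j ≢ x
              j≢x refl = k≢y (partner-unique (N-sym Nkj) Nxy)
              j≢y : j ≢ y
              j≢y refl = k≢x (partner-unique (N-sym Nkj) (N-sym Nxy))

      -- x ∈ support F₂: add x and its partner y in F₂ to the support of F₁.
      entering : w₁ x ≡ false → Exchanged
      entering w₁x with matched₂ x w₂x
        where
          w₂x : w₂ x ≡ true
          w₂x = trans (sym (cong (_xor w₂ x) w₁x)) (trans (sym (lookup-F₁ΔF₂ x)) x∈)
      ... | y , w₂y , Nxy = y , ∈-lookup (trans (lookup-F₁ΔF₂ y) (cong₂ _xor_ w₁y w₂y)) , feasible′ y matched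
        where
          w₁y : w₁ y ≡ false
          w₁y = ≢true⇒≡false (λ w₁y → let (z , w₁z , Nyz) = matched₁ y w₁y in
                  bit-conflict (subst (λ z → w₁ z ≡ true) (sym (partner-unique (N-sym Nxy) Nyz)) w₁z) w₁x)
          matched : Matched (w′ y)
          matched k = byCases (k ≟ x) (k ≟ y)
            where
            byCases : Dec (k ≡ x) → Dec (k ≡ y) → w′ y k ≡ true → ∃ λ j → w′ y j ≡ true × N k j ≡ true
            byCases (yes refl) _          _   = y , trans (w′-y y) (cong not w₁y) , Nxy
            byCases (no _)     (yes refl) _   = x , trans (w′-x y) (cong not w₁x) , N-sym Nxy
            byCases (no k≢x)   (no k≢y)   w′k with matched₁ k (trans (sym (w′-other y k≢x k≢y)) w′k)
            ... | j , w₁j , Nkj = j , trans (w′-other y j≢x j≢y) w₁j , Nkj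
              where
              j≢x : j ≢ x
              j≢x refl = bit-conflict w₁j w₁x
              j≢y : j ≢ y
              j≢y refl = bit-conflict w₁j w₁y

      exchanged : Exchanged
      exchanged with w₁ x in w₁x
      ... | true  = leaving w₁x
      ... | false = entering w₁x

    deltaMatroid : IsDeltaMatroid (family F N)
    deltaMatroid = (minimum , minimum-feasible) ,
      λ F₁ F₂ x feasible₁ feasible₂ x∈ → Exchange.exchanged F₁ F₂ x feasible₁ feasible₂ (lookup-∈ x∈)

proposition2 : (n : ℕ) (𝓕 : Family n) → IsDeltaMatroid 𝓕 → IsBinary 𝓕 →
    ∃ λ (s : List (Fin n × Fin n)) → ValidSlides s ×
      IsDeltaMatroid (applySlides s 𝓕) ×
      UniqueMin (applySlides s 𝓕) × UniqueMax (applySlides s 𝓕)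
proposition2 n 𝓕 _ (F , _ , A , A-sym , 𝓕≐twist) with NormalForm.normalise F A A-sym
... | N , (s , valid , slides) , normal =
  s , valid , IsDeltaMatroid-≐ normal≐ (deltaMatroid normal) , UniqueMin-≐ normal≐ (uniqueMin normal) , UniqueMax-≐ normal≐ (uniqueMax normal)
  where
    open NormalFamily F N
    normal≐ : family F N ≐ applySlides s 𝓕
    normal≐ = ≐-sym (slides 𝓕 (≐-trans 𝓕≐twist (twist≐family F A)))
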